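{- Let $m$ be a Carmichael number with exactly three prime factors such that $m\notin\mathcal C'_3$. Then $m\in(\mathcal S'\cap\mathcal L)\setminus\mathcal S$, and the greatest prime divisor $p$ of $m$ satisfies $s_p(m)=p$. Moreover, writing $m=p_1p_2p_3$ with primes $p_1<p_2<p_3$, $u=\gcd(p_1-1,p_2-1,p_3-1)$ and $\mathbf r=((p_1-1)/u,(p_2-1)/u,(p_3-1)/u)$, we have $\mathbf r\in\mathcal R$ and there is an integer $t$ with $m=U_{\mathbf r}(t)$ and $0\le t<\tau$, where $\tau=2$ if $r_1=1$ and $\ell<\sigma_3-\sigma_1$, and $\tau=1$ otherwise. In the case $(\tau,t)=(2,1)$, the second greatest prime divisor $p_2$ of $m$ also satisfies $s_{p_2}(m)=p_2$.
   Context: For an integer base $g\ge2$ and $m\ge0$, $s_g(m)$ is the sum of base-$g$ digits of $m$. A Carmichael number is a composite positive $m$ with $a^{m-1}\equiv1\pmod m$ for all $a$ coprime to $m$. $\mathcal C'_3$ is the set of squarefree $m>1$ with exactly three prime factors and $s_p(m)=p$ for every prime $p\mid m$. An $s$-decomposition of a positive integer $m$ is a factorization $m=\prod_{\nu=1}^n g_\nu^{e_\nu}$, $e_\nu\ge1$, with proper factors $1<g_\nu<m$, $g_1<\dots<g_n$ (not necessarily coprime), and $s_{g_\nu}(m)\ge g_\nu$ for all $\nu$; it is strict if $s_{g_\nu}(m)=g_\nu$ for all $\nu$. $\mathcal S'$ (resp. $\mathcal S$) is the set of positive integers admitting an $s$-decomposition (resp. strict one). $\mathcal L$ is the set of positive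 integers $m$ having a divisor $g$ with $s_g(m)=g$. $\mathcal R$ is the set of triples $\mathbf r=(r_1,r_2,r_3)$ of pairwise coprime positive integers with $r_1<r_2<r_3$; for such $\mathbf r$, $\sigma_1=r_1+r_2+r_3$, $\sigma_2=r_1r_2+r_1r_3+r_2r_3$, $\sigma_3=r_1r_2r_3$, $\ell$ is the unique integer with $0\le\ell<\sigma_3$ and $\ell\sigma_2\equiv-\sigma_1\pmod{\sigma_3}$, and $U_{\mathbf r}(t)=\prod_{\nu=1}^3(r_\nu(\sigma_3t+\ell)+1)$. -}

module Defs where

open import Data.Nat using (ℕ; zero; suc; _+_; _*_; _∸_; _^_; _≤_; _<_; _<?_)
open import Data.Nat.DivMod using (_/_; _%_)
open import Data.Nat.Divisibility using (_∣_)
open import Data.Nat.Primality using (Prime; Composite)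
open import Data.Nat.Coprimality using (Coprime)
open import Data.List using (List; []; _∷_; map)
open import Data.Nat.ListAction using (product)
open import Data.List.Relation.Unary.All using (All)
open import Data.List.Relation.Unary.Linked using (Linked)
open import Data.Product using (Σ; ∃; _×_; _,_; proj₁)
open import Relation.Binary.PropositionalEquality using (_≡_)
open import Relation.Nullary using (¬_; yes; no)

-- digit sum of m in base (2+k), with fuel (fuel m suffices)
digitSumAux : ℕ → ℕ → ℕ → ℕ
digitSumAux zero    k m = 0
digitSumAux (suc f) k m = m % suc (suc k) + digitSumAux f k (m / suc (suc k))

-- s g m : sum of base-g digits of m.  Only meaningful for g ≥ 2;
-- for g ∈ {0,1} we arbitrarily return m (never used with g < 2 below).
s : ℕ → ℕ → ℕ
s zero          m = m
s (suc zero)    m = m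
s (suc (suc k)) m = digitSumAux m k m

Carmichael : ℕ → Set
Carmichael m = Composite m × (∀ a → Coprime a m → ∃ λ k → a ^ (m ∸ 1) ≡ 1 + k * m)

ThreePrimeFactors : ℕ → Set
ThreePrimeFactors m = ∃ λ p → ∃ λ q → ∃ λ r →
  Prime p × Prime q × Prime r × m ≡ p * q * r

SquareFree : ℕ → Set
SquareFree m = ∀ d → d * d ∣ m → d ≡ 1

C3' : ℕ → Set
C3' m = 1 < m × SquareFree m × ThreePrimeFactors m ×
        (∀ p → Prime p → p ∣ m → s p m ≡ p)

-- an s-decomposition given as a nonempty list of pairs (g_ν , e_ν)
IsSDecomp : (ℕ → ℕ → Set) → ℕ → List (ℕ × ℕ) → Set
IsSDecomp Rel m gs =
  ¬ (gs ≡ []) ×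
  All (λ { (g , e) → 1 ≤ e × 1 < g × g < m × Rel g (s g m) }) gs ×
  Linked _<_ (map proj₁ gs) ×
  product (map (λ { (g , e) → g ^ e }) gs) ≡ m

InS' : ℕ → Set
InS' m = ∃ λ gs → IsSDecomp (λ g sg → g ≤ sg) m gs

InS : ℕ → Set
InS m = ∃ λ gs → IsSDecomp (λ g sg → sg ≡ g) m gs

-- L : has a divisor g (≥ 2, so that base g makes sense) with s_g(m) = g
InL : ℕ → Set
InL m = ∃ λ g → 2 ≤ g × g ∣ m × s g m ≡ g

InR : ℕ → ℕ → ℕ → Set
InR r₁ r₂ r₃ = 0 < r₁ × r₁ < r₂ × r₂ < r₃ ×
  Coprime r₁ r₂ × Coprime r₁ r₃ × Coprime r₂ r₃

σ₁ σ₂ σ₃ : ℕ → ℕ → ℕ → ℕ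
σ₁ r₁ r₂ r₃ = r₁ + r₂ + r₃
σ₂ r₁ r₂ r₃ = r₁ * r₂ + r₁ * r₃ + r₂ * r₃
σ₃ r₁ r₂ r₃ = r₁ * r₂ * r₃

-- ℓ is the integer with 0 ≤ ℓ < σ₃ and ℓ σ₂ ≡ -σ₁ (mod σ₃)
IsEll : ℕ → ℕ → ℕ → ℕ → Set
IsEll r₁ r₂ r₃ ℓ = ℓ < σ₃ r₁ r₂ r₃ × σ₃ r₁ r₂ r₃ ∣ ℓ * σ₂ r₁ r₂ r₃ + σ₁ r₁ r₂ r₃

U : ℕ → ℕ → ℕ → ℕ → ℕ → ℕ
U r₁ r₂ r₃ ℓ t = (r₁ * (σ₃ r₁ r₂ r₃ * t + ℓ) + 1)
               * (r₂ * (σ₃ r₁ r₂ r₃ * t + ℓ) + 1)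
               * (r₃ * (σ₃ r₁ r₂ r₃ * t + ℓ) + 1)

-- τ = 2 if r₁ = 1 and ℓ < σ₃ - σ₁ (as integers), τ = 1 otherwise.
-- Since ℓ ≥ 0, "ℓ < σ₃ - σ₁" over ℤ is equivalent to ℓ < σ₃ ∸ σ₁ over ℕ.
τ : ℕ → ℕ → ℕ → ℕ → ℕ
τ (suc zero) r₂ r₃ ℓ with _<?_ ℓ (σ₃ 1 r₂ r₃ ∸ σ₁ 1 r₂ r₃)
... | yes _ = 2
... | no  _ = 1
τ _ r₂ r₃ ℓ = 1

GreatestPrimeDivisor : ℕ → ℕ → Set
GreatestPrimeDivisor m p = Prime p × p ∣ m × (∀ q → Prime q → q ∣ m → q ≤ p)

-- Korselt's criterion, proved from Fermat's little theorem and the fact that X^r − 1 has at most r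
-- roots modulo a prime, gives pᵢ − 1 ∣ m − 1 for each prime factor of m = p₁p₂p₃.  Writing
-- pᵢ = rᵢu + 1 with u = gcd (pᵢ − 1), this says rᵢ ∣ rⱼrₖu + rⱼ + rₖ, which makes the rᵢ pairwise
-- coprime and gives σ₃ ∣ uσ₂ + σ₁; hence u = σ₃t + ℓ and m = U(t).  In base pᵢ the cofactor m/pᵢ
-- has at most three digits, which can be written down explicitly: they always sum to p₃ for p₃,
-- for p₂ (and for p₁ when r₁ > 1) they do as soon as t ≥ 1, and for p₁ when r₁ = 1 as soon as
-- t ≥ τ.  As m ∉ C′₃, this forces t < τ.  Digit sums are ≡ m ≡ 1 (mod p − 1) and m is not a
-- power of p, so s_p(m) ≥ p for all three primes and m ∈ S′ ∩ L.  A strict s-decomposition is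
-- impossible: a factor g = pᵢpⱼ has s_g(m) = m/g < g, so both p₁ and p₂ would be factors with
-- s_p(m) = p, putting m in C′₃.

module Submission where

open import Defs
open import Data.Nat
open import Data.Nat.Properties
open import Data.Nat.Divisibility
open import Data.Nat.DivMod
open import Data.Nat.Primality
open import Data.Nat.Induction using (<-rec)
open import Data.Nat.GCD using (gcd; gcd[m,n]∣m; gcd[m,n]∣n; gcd-greatest)
open import Data.Nat.Coprimality using (Coprime; coprime-divisor) renaming (sym to coprime-sym)
open import Data.Nat.Combinatorics using (nCn≡1; k![n∸k]!∣n!) renaming (_C_ to _choose_)
open import Data.Nat.Combinatorics.Specification using (nCk≡n!/k![n-k]!)
open import Data.Nat.ListAction using (product)
open import Data.Nat.Tactic.RingSolver using (solve-∀)
open import Data.Fin using (zero; suc; toℕ; inject₁; fromℕ)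
open import Data.Fin.Properties using (toℕ<n; toℕ-inject₁; toℕ-fromℕ)
open import Data.Vec.Functional using (Vector; init; last; tail)
open import Data.List using (List; []; _∷_; length; map; applyUpTo)
open import Data.List.Properties using (length-applyUpTo)
open import Data.List.Relation.Unary.All using (All; []; _∷_; zipWith)
open import Data.List.Relation.Unary.AllPairs using (AllPairs; []; _∷_)
open import Data.List.Relation.Unary.Linked using ([-]; _∷_)
import Data.List.Relation.Unary.All.Properties as All
import Data.List.Relation.Unary.AllPairs.Properties as AllPairs
open import Data.Product using (∃; _×_; _,_; proj₁; proj₂)
open import Data.Sum using (_⊎_; inj₁; inj₂)
import Data.Sum as Sum
open import Data.Empty using (⊥-elim)
open import Function using (_∘_)
open import Relation.Nullary using (¬_; yes; no)
open import Relation.Binary.Definitions using (tri<; tri≈; tri>)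
open import Relation.Binary.PropositionalEquality
open import Algebra.Properties.CommutativeSemigroup *-commutativeSemigroup
  using (xy∙z≈y∙xz; xy∙z≈z∙xy; xy∙z≈xz∙y; xy∙z≈yx∙z; xy∙z≈yz∙x; xy∙z≈zx∙y; xy∙z≈zy∙x)
import Algebra.Definitions.RawSemiring as RawSemiring
import Algebra.Properties.CommutativeSemiring.Binomial as Binomial
import Algebra.Properties.Monoid.Sum as MonoidSum

open RawSemiring +-*-rawSemiring using (sum) renaming (_×_ to _×ℕ_; _^_ to _^ℕ_)
open MonoidSum +-0-monoid using (sum-init-last)

-- Congruences modulo a prime and Fermat's little theorem

prime⇒>1 : ∀ {p} → Prime p → 1 < p
prime⇒>1 {p} pp = nonTrivial⇒n>1 p {{prime⇒nonTrivial pp}}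

module _ {p : ℕ} .{{_ : NonZero p}} where

  %-cong-+ : ∀ {a b c d} → a % p ≡ b % p → c % p ≡ d % p → (a + c) % p ≡ (b + d) % p
  %-cong-+ {a} {b} {c} {d} a≡b c≡d = begin
    (a + c) % p            ≡⟨ %-distribˡ-+ a c p ⟩
    (a % p + c % p) % p    ≡⟨ cong₂ (λ x y → (x + y) % p) a≡b c≡d ⟩
    (b % p + d % p) % p    ≡⟨ %-distribˡ-+ b d p ⟨
    (b + d) % p            ∎
    where open ≡-Reasoning

  %-cong-* : ∀ {a b c d} → a % p ≡ b % p → c % p ≡ d % p → (a * c) % p ≡ (b * d) % p
  %-cong-* {a} {b} {c} {d} a≡b c≡d = begin
    (a * c) % p              ≡⟨ %-distribˡ-* a c p ⟩
    (a % p * (c % p)) % p    ≡⟨ cong₂ (λ x y → (x * y) % p) a≡b c≡d ⟩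
    (b % p * (d % p)) % p    ≡⟨ %-distribˡ-* b d p ⟨
    (b * d) % p              ∎
    where open ≡-Reasoning

  %-cong-^ : ∀ {a b} e → a % p ≡ b % p → (a ^ e) % p ≡ (b ^ e) % p
  %-cong-^ zero    a≡b = refl
  %-cong-^ (suc e) a≡b = %-cong-* a≡b (%-cong-^ e a≡b)

  %≡%⇒∣∸ : ∀ {a b} → b ≤ a → a % p ≡ b % p → p ∣ a ∸ b
  %≡%⇒∣∸ {a} {b} b≤a a≡b = divides (a / p ∸ b / p) (begin
    a ∸ b                                          ≡⟨ cong₂ _∸_ (m≡m%n+[m/n]*n a p) (m≡m%n+[m/n]*n b p) ⟩
    (a % p + a / p * p) ∸ (b % p + b / p * p)      ≡⟨ cong (λ z → (z + a / p * p) ∸ (b % p + b / p * p)) a≡b ⟩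
    (b % p + a / p * p) ∸ (b % p + b / p * p)      ≡⟨ [m+n]∸[m+o]≡n∸o (b % p) (a / p * p) (b / p * p) ⟩
    a / p * p ∸ b / p * p                          ≡⟨ *-distribʳ-∸ p (a / p) (b / p) ⟨
    (a / p ∸ b / p) * p                            ∎)
    where open ≡-Reasoning

  ∣∸⇒%≡% : ∀ {a b} → b ≤ a → p ∣ a ∸ b → a % p ≡ b % p
  ∣∸⇒%≡% {a} {b} b≤a (divides k a∸b≡kp) = begin
    a % p              ≡⟨ cong (_% p) (m+[n∸m]≡n b≤a) ⟨
    (b + (a ∸ b)) % p  ≡⟨ cong (λ z → (b + z) % p) a∸b≡kp ⟩
    (b + k * p) % p    ≡⟨ [m+kn]%n≡m%n b k p ⟩
    b % p              ∎
    where open ≡-Reasoning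

module _ {p : ℕ} .{{_ : NonZero p}} (pp : Prime p) {c : ℕ} where

  private
    %-*-cancelʳ-≤ : ∀ {a b} → b ≤ a → (a * c) % p ≡ (b * c) % p → p ∣ c ⊎ a % p ≡ b % p
    %-*-cancelʳ-≤ {a} {b} b≤a ac≡bc with euclidsLemma (a ∸ b) c pp
      (subst (p ∣_) (sym (*-distribʳ-∸ c a b)) (%≡%⇒∣∸ (*-monoˡ-≤ c b≤a) ac≡bc))
    ... | inj₁ p∣a∸b = inj₂ (∣∸⇒%≡% b≤a p∣a∸b)
    ... | inj₂ p∣c   = inj₁ p∣c

  %-*-cancelʳ : ∀ {a b} → (a * c) % p ≡ (b * c) % p → p ∣ c ⊎ a % p ≡ b % p
  %-*-cancelʳ {a} {b} ac≡bc with ≤-total b a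
  ... | inj₁ b≤a = %-*-cancelʳ-≤ b≤a ac≡bc
  ... | inj₂ a≤b = Sum.map₂ sym (%-*-cancelʳ-≤ a≤b (sym ac≡bc))

×ℕ≗* : ∀ n x → n ×ℕ x ≡ n * x
×ℕ≗* zero    x = refl
×ℕ≗* (suc n) x = cong (x +_) (×ℕ≗* n x)

^ℕ≗^ : ∀ x n → x ^ℕ n ≡ x ^ n
^ℕ≗^ x zero    = refl
^ℕ≗^ x (suc n) = cong (x *_) (^ℕ≗^ x n)

∣-sum : ∀ {d n} (t : Vector ℕ n) → (∀ i → d ∣ t i) → d ∣ sum t
∣-sum {n = zero}  t h = _ ∣0
∣-sum {n = suc n} t h = ∣m∣n⇒∣m+n (h zero) (∣-sum (tail t) (h ∘ suc))

prime∣n!⇒≤ : ∀ {p} → Prime p → ∀ n → p ∣ n ! → p ≤ n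
prime∣n!⇒≤ pp zero p∣1 = ⊥-elim (<⇒≱ (prime⇒>1 pp) (∣⇒≤ p∣1))
prime∣n!⇒≤ pp (suc n) p∣n! with euclidsLemma (suc n) (n !) pp p∣n!
... | inj₁ p∣1+n = ∣⇒≤ p∣1+n
... | inj₂ p∣n!  = m≤n⇒m≤1+n (prime∣n!⇒≤ pp n p∣n!)

prime∣p-choose-k : ∀ {p k} → Prime p → 0 < k → k < p → p ∣ p choose k
prime∣p-choose-k {p@(suc q)} {k} pp 0<k k<p with euclidsLemma (k ! * (p ∸ k) !) (p choose k) pp p∣product
  where
  instance _ = k !* (p ∸ k) !≢0
  p∣product : p ∣ k ! * (p ∸ k) ! * (p choose k)
  p∣product = divides (q !) (begin
    k ! * (p ∸ k) ! * (p choose k)                ≡⟨ cong (k ! * (p ∸ k) ! *_) (nCk≡n!/k![n-k]! (<⇒≤ k<p)) ⟩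
    k ! * (p ∸ k) ! * (p ! / (k ! * (p ∸ k) !))   ≡⟨ m*[n/m]≡n (k![n∸k]!∣n! (<⇒≤ k<p)) ⟩
    p * q !                                       ≡⟨ *-comm p (q !) ⟩
    q ! * p                                       ∎)
    where open ≡-Reasoning
... | inj₂ p∣p-choose-k = p∣p-choose-k
... | inj₁ p∣k![p∸k]! with euclidsLemma (k !) ((p ∸ k) !) pp p∣k![p∸k]!
...   | inj₁ p∣k! = ⊥-elim (<⇒≱ k<p (prime∣n!⇒≤ pp k p∣k!))
...   | inj₂ p∣[p∸k]! = ⊥-elim (<⇒≱ (∸-monoʳ-< 0<k (<⇒≤ k<p)) (prime∣n!⇒≤ pp (p ∸ k) p∣[p∸k]!))

freshmansDream : ∀ {p} → Prime p → ∀ a b → ∃ λ M → p ∣ M × (a + b) ^ p ≡ a ^ p + b ^ p + M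
freshmansDream {p@(suc q)} pp a b = sum middle , p∣middle , (begin
  (a + b) ^ p                                   ≡⟨ ^ℕ≗^ (a + b) p ⟨
  (a + b) ^ℕ p                                  ≡⟨ Binomial.theorem +-*-commutativeSemiring p a b ⟩
  term zero + sum (tail term)                   ≡⟨ cong (term zero +_) (sum-init-last (tail term)) ⟩
  term zero + (sum middle + last (tail term))   ≡⟨ cong₂ (λ x y → x + (sum middle + y)) first-term last-term ⟩
  b ^ p + (sum middle + a ^ p)                  ≡⟨ rearrange (b ^ p) (sum middle) (a ^ p) ⟩
  a ^ p + b ^ p + sum middle                    ∎)
  where
  open ≡-Reasoning
  rearrange : ∀ x y z → x + (y + z) ≡ z + x + y
  rearrange = solve-∀
  term : Vector ℕ (suc p)
  term k = (p choose toℕ k) ×ℕ (a ^ℕ toℕ k * b ^ℕ (p ∸ toℕ k))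
  middle : Vector ℕ q
  middle = init (tail term)
  term≡ : ∀ k → term k ≡ (p choose toℕ k) * (a ^ toℕ k * b ^ (p ∸ toℕ k))
  term≡ k = trans (×ℕ≗* (p choose toℕ k) _)
    (cong ((p choose toℕ k) *_) (cong₂ _*_ (^ℕ≗^ a (toℕ k)) (^ℕ≗^ b (p ∸ toℕ k))))
  first-term : term zero ≡ b ^ p
  first-term = trans (term≡ zero) (trans (*-identityˡ _) (*-identityˡ _))
  last-term : last (tail term) ≡ a ^ p
  last-term = begin
    last (tail term)                      ≡⟨ term≡ (suc (fromℕ q)) ⟩
    (p choose k) * (a ^ k * b ^ (p ∸ k))  ≡⟨ cong (λ k → (p choose k) * (a ^ k * b ^ (p ∸ k))) (cong suc (toℕ-fromℕ q)) ⟩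
    (p choose p) * (a ^ p * b ^ (p ∸ p))  ≡⟨ cong₂ (λ c e → c * (a ^ p * b ^ e)) (nCn≡1 p) (n∸n≡0 p) ⟩
    1 * (a ^ p * 1)                       ≡⟨ trans (*-identityˡ _) (*-identityʳ _) ⟩
    a ^ p                                 ∎
    where k = toℕ (suc (fromℕ q))
  p∣term : ∀ k → 0 < toℕ k → toℕ k < p → p ∣ term k
  p∣term k 0<k k<p = subst (p ∣_) (sym (term≡ k)) (∣m⇒∣m*n _ (prime∣p-choose-k pp 0<k k<p))
  p∣middle : p ∣ sum middle
  p∣middle = ∣-sum middle λ i → p∣term (suc (inject₁ i)) z<s (s≤s (subst (_< q) (sym (toℕ-inject₁ i)) (toℕ<n i)))

fermat : ∀ {p} .{{_ : NonZero p}} → Prime p → ∀ a → (a ^ p) % p ≡ a % p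
fermat {p@(suc q)} pp zero    = refl
fermat {p}         pp (suc a) with freshmansDream pp 1 a
... | M , p∣M , [1+a]^p≡ = begin
  (1 + a) ^ p % p          ≡⟨ cong (_% p) [1+a]^p≡ ⟩
  (1 ^ p + a ^ p + M) % p  ≡⟨ %-remove-+ʳ (1 ^ p + a ^ p) p∣M ⟩
  (1 ^ p + a ^ p) % p      ≡⟨ %-cong-+ (cong (_% p) (^-zeroˡ p)) (fermat pp a) ⟩
  (1 + a) % p              ∎
  where open ≡-Reasoning

fermat-∤ : ∀ {p} .{{_ : NonZero p}} → Prime p → ∀ {a} → ¬ p ∣ a → (a ^ (p ∸ 1)) % p ≡ 1 % p
fermat-∤ {p@(suc q)} pp {a} p∤a with %-*-cancelʳ pp {a} {a ^ q} {1} a^q*a≡1*a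
  where
  a^q*a≡1*a : (a ^ q * a) % p ≡ (1 * a) % p
  a^q*a≡1*a = trans (cong (_% p) (*-comm (a ^ q) a)) (trans (fermat pp a) (cong (_% p) (sym (*-identityˡ a))))
... | inj₁ p∣a = ⊥-elim (p∤a p∣a)
... | inj₂ eq  = eq

-- Polynomial congruences and Korselt's criterion

⟦_⟧ : List ℕ → ℕ → ℕ
⟦ []     ⟧ x = 0
⟦ c ∷ cs ⟧ x = c + x * ⟦ cs ⟧ x

leading : List ℕ → ℕ
leading []           = 0
leading (c ∷ [])     = c
leading (c ∷ d ∷ cs) = leading (d ∷ cs)

divideByRoot : ℕ → List ℕ → List ℕ
divideByRoot a []           = []
divideByRoot a (c ∷ [])     = []
divideByRoot a (c ∷ d ∷ cs) = ⟦ d ∷ cs ⟧ a ∷ divideByRoot a (d ∷ cs)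

-- f(x) − f(a) = (x − a) q(x), with both sides moved so that no subtraction occurs.
divideByRoot-correct : ∀ a f x → ⟦ f ⟧ x + a * ⟦ divideByRoot a f ⟧ x ≡ x * ⟦ divideByRoot a f ⟧ x + ⟦ f ⟧ a
divideByRoot-correct a []       x = lemma a x
  where
  lemma : ∀ a x → a * 0 ≡ x * 0 + 0
  lemma = solve-∀
divideByRoot-correct a (c ∷ []) x = lemma c a x
  where
  lemma : ∀ c a x → c + x * 0 + a * 0 ≡ x * 0 + (c + a * 0)
  lemma = solve-∀
divideByRoot-correct a (c ∷ d ∷ cs) x = begin
  c + x * g + a * (e + x * q)   ≡⟨ lemma₁ c x g a e q ⟩
  c + a * e + x * (g + a * q)   ≡⟨ cong (λ z → c + a * e + x * z) (divideByRoot-correct a (d ∷ cs) x) ⟩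
  c + a * e + x * (x * q + e)   ≡⟨ lemma₂ c x a e q ⟩
  x * (e + x * q) + (c + a * e) ∎
  where
  open ≡-Reasoning
  g e q : ℕ
  g = ⟦ d ∷ cs ⟧ x
  e = ⟦ d ∷ cs ⟧ a
  q = ⟦ divideByRoot a (d ∷ cs) ⟧ x
  lemma₁ : ∀ c x g a e q → c + x * g + a * (e + x * q) ≡ c + a * e + x * (g + a * q)
  lemma₁ = solve-∀
  lemma₂ : ∀ c x a e q → c + a * e + x * (x * q + e) ≡ x * (e + x * q) + (c + a * e)
  lemma₂ = solve-∀

length-divideByRoot : ∀ a c cs → length (divideByRoot a (c ∷ cs)) ≡ length cs
length-divideByRoot a c []       = refl
length-divideByRoot a c (d ∷ cs) = cong suc (length-divideByRoot a d cs)

leading-divideByRoot : ∀ a c d cs → leading (divideByRoot a (c ∷ d ∷ cs)) ≡ leading (d ∷ cs)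
leading-divideByRoot a c d []       = trans (cong (d +_) (*-zeroʳ a)) (+-identityʳ d)
leading-divideByRoot a c d (e ∷ cs) = leading-divideByRoot a d e cs

module _ {p : ℕ} .{{_ : NonZero p}} (pp : Prime p) where

  Root : List ℕ → ℕ → Set
  Root f x = p ∣ ⟦ f ⟧ x

  Distinct : ℕ → ℕ → Set
  Distinct a b = a % p ≢ b % p

  root-divideByRoot : ∀ {a b} f → Distinct a b → Root f a → Root f b → Root (divideByRoot a f) b
  root-divideByRoot {a} {b} f a≢b fa fb with %-*-cancelʳ pp {⟦ divideByRoot a f ⟧ b} {a} {b} aq≡bq
    where
    q : ℕ
    q = ⟦ divideByRoot a f ⟧ b
    aq≡bq : (a * q) % p ≡ (b * q) % p
    aq≡bq = begin
      (a * q) % p             ≡⟨ %-remove-+ˡ (a * q) fb ⟨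
      (⟦ f ⟧ b + a * q) % p   ≡⟨ cong (_% p) (divideByRoot-correct a f b) ⟩
      (b * q + ⟦ f ⟧ a) % p   ≡⟨ %-remove-+ʳ (b * q) fa ⟩
      (b * q) % p             ∎
      where open ≡-Reasoning
  ... | inj₁ p∣q = p∣q
  ... | inj₂ a≡b = ⊥-elim (a≢b a≡b)

  roots-length< : ∀ f → ¬ p ∣ leading f → ∀ {xs} → AllPairs Distinct xs → All (Root f) xs → length xs < length f
  roots-length< []           p∤lead _ _ = ⊥-elim (p∤lead (p ∣0))
  roots-length< (c ∷ cs)     p∤lead {[]} _ _ = z<s
  roots-length< (c ∷ [])     p∤lead {a ∷ xs} _ (fa ∷ _) =
    ⊥-elim (p∤lead (subst (p ∣_) (trans (cong (c +_) (*-zeroʳ a)) (+-identityʳ c)) fa))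
  roots-length< (c ∷ d ∷ cs) p∤lead {a ∷ xs} (a≢xs ∷ distinct) (fa ∷ fxs) =
    s≤s (subst (length xs <_) (length-divideByRoot a c (d ∷ cs))
      (roots-length< (divideByRoot a (c ∷ d ∷ cs)) (p∤lead ∘ subst (p ∣_) (leading-divideByRoot a c d cs))
        distinct (zipWith (λ (a≢x , fx) → root-divideByRoot (c ∷ d ∷ cs) a≢x fa fx) (a≢xs , fxs))))

X^_ : ℕ → List ℕ
X^ zero  = 1 ∷ []
X^ suc n = 0 ∷ X^ n

⟦X^⟧ : ∀ n x → ⟦ X^ n ⟧ x ≡ x ^ n
⟦X^⟧ zero    x = cong suc (*-zeroʳ x)
⟦X^⟧ (suc n) x = cong (x *_) (⟦X^⟧ n x)

leading-X^ : ∀ c n → leading (c ∷ X^ n) ≡ 1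
leading-X^ c zero    = refl
leading-X^ c (suc n) = leading-X^ 0 n

length-X^ : ∀ n → length (X^ n) ≡ suc n
length-X^ zero    = refl
length-X^ (suc n) = cong suc (length-X^ n)

-- If every unit a satisfies a^e ≡ 1 then so does a^r for r = e mod (p − 1), so the polynomial
-- X^r + (p − 1) ≡ X^r − 1 has all p − 1 units as roots, which forces r = 0.
units^e≡1⇒p∸1∣e : ∀ {p} .{{_ : NonZero p}} → Prime p → ∀ e →
                 (∀ a → 0 < a → a < p → (a ^ e) % p ≡ 1 % p) → p ∸ 1 ∣ e
units^e≡1⇒p∸1∣e {1} pp e _ = ⊥-elim (<-irrefl refl (prime⇒>1 pp))
units^e≡1⇒p∸1∣e {p@(suc k@(suc n))} pp e a^e≡1 with e % k in r≡e%k
... | zero   = m%n≡0⇒n∣m e k r≡e%k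
... | suc r′ = ⊥-elim (<⇒≱ (subst (_< k) r≡e%k (m%n<n e k)) k≤r)
  where
  r : ℕ
  r = suc r′
  f : List ℕ
  f = k ∷ X^ r′
  units : List ℕ
  units = applyUpTo suc k
  a^r≡1 : ∀ a → 0 < a → a < p → (a ^ r) % p ≡ 1 % p
  a^r≡1 a 0<a a<p = begin
    a ^ r % p                    ≡⟨ cong (_% p) (*-identityʳ (a ^ r)) ⟨
    (a ^ r * 1) % p              ≡⟨ cong (λ z → (a ^ r * z) % p) (^-zeroˡ q) ⟨
    (a ^ r * 1 ^ q) % p          ≡⟨ %-cong-* {a = a ^ r} {b = a ^ r} refl (%-cong-^ q (fermat-∤ pp p∤a)) ⟨
    (a ^ r * (a ^ k) ^ q) % p    ≡⟨ cong (λ z → (a ^ r * z) % p) (^-*-assoc a k q) ⟩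
    (a ^ r * a ^ (k * q)) % p    ≡⟨ cong (_% p) (^-distribˡ-+-* a r (k * q)) ⟨
    a ^ (r + k * q) % p          ≡⟨ cong (λ z → a ^ z % p) e≡r+kq ⟨
    a ^ e % p                    ≡⟨ a^e≡1 a 0<a a<p ⟩
    1 % p                        ∎
    where
    open ≡-Reasoning
    q : ℕ
    q = e / k
    e≡r+kq : e ≡ r + k * q
    e≡r+kq = trans (m≡m%n+[m/n]*n e k) (cong₂ _+_ r≡e%k (*-comm q k))
    p∤a : ¬ p ∣ a
    p∤a p∣a = <⇒≱ a<p (∣⇒≤ {{>-nonZero 0<a}} p∣a)
  unit-root : ∀ a → 0 < a → a < p → Root pp f a
  unit-root a 0<a a<p = m%n≡0⇒n∣m _ p (begin
    (k + a * ⟦ X^ r′ ⟧ a) % p  ≡⟨ cong (λ z → (k + a * z) % p) (⟦X^⟧ r′ a) ⟩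
    (k + a ^ r) % p            ≡⟨ %-cong-+ {a = k} {b = k} refl (a^r≡1 a 0<a a<p) ⟩
    (k + 1 % p) % p            ≡⟨ cong (λ z → (k + z) % p) (m<n⇒m%n≡m (s≤s (s≤s z≤n))) ⟩
    (k + 1) % p                ≡⟨ cong (_% p) (+-comm k 1) ⟩
    p % p                      ≡⟨ n%n≡0 p ⟩
    0                          ∎)
    where open ≡-Reasoning
  distinct : AllPairs (Distinct pp) units
  distinct = AllPairs.applyUpTo⁺₁ suc k λ {i} {j} i<j j<k i≡j →
    <-irrefl (trans (sym (m<n⇒m%n≡m (s≤s (<-trans i<j j<k)))) (trans i≡j (m<n⇒m%n≡m (s≤s j<k)))) (s≤s i<j)
  k≤r : k ≤ r
  k≤r = ≤-pred (subst₂ _<_ (length-applyUpTo suc k) (cong suc (length-X^ r′))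
          (roots-length< pp f (λ p∣lead → <⇒≱ (prime⇒>1 pp) (∣⇒≤ (subst (p ∣_) (leading-X^ k r′) p∣lead))) distinct
            (All.applyUpTo⁺₁ suc k λ {i} i<k → unit-root (suc i) z<s (s≤s i<k))))

coprime-*ʳ : ∀ {a b c} → Coprime a b → Coprime a c → Coprime a (b * c)
coprime-*ʳ {a} {b} {c} a⊥b a⊥c {d} (d∣a , d∣bc) = a⊥c (d∣a , coprime-divisor d⊥b d∣bc)
  where
  d⊥b : Coprime d b
  d⊥b {e} (e∣d , e∣b) = a⊥b (∣-trans e∣d d∣a , e∣b)

coprime-1+ : ∀ {n x} → n ∣ x → Coprime (1 + x) n
coprime-1+ {n} {x} n∣x {d} (d∣1+x , d∣n) = ∣1⇒≡1 (∣m+n∣m⇒∣n (subst (d ∣_) (+-comm 1 x) d∣1+x) (∣-trans d∣n n∣x))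

prime∤⇒coprime : ∀ {p a} → Prime p → ¬ p ∣ a → Coprime a p
prime∤⇒coprime pp p∤a {d} (d∣a , d∣p) with prime⇒irreducible pp d∣p
... | inj₁ d≡1 = d≡1
... | inj₂ refl = ⊥-elim (p∤a d∣a)

carmichael-%∣ : ∀ {m} → Carmichael m → ∀ {p} .{{_ : NonZero p}} → p ∣ m →
                ∀ a → Coprime a m → (a ^ (m ∸ 1)) % p ≡ 1 % p
carmichael-%∣ {m} (_ , fermat-m) {p} p∣m a a⊥m with fermat-m a a⊥m
... | k , a^[m-1]≡1+km = trans (cong (_% p) a^[m-1]≡1+km) (%-remove-+ʳ 1 (∣n⇒∣m*n k p∣m))

-- Lift a unit a mod p to A ≡ a (mod p) with A ≡ 1 (mod n), so that A is coprime to m.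
korselt : ∀ {m p n} → Carmichael m → Prime p → m ≡ p * n → ¬ p ∣ n → p ∸ 1 ∣ m ∸ 1
korselt {m} {p} {n} carm pp refl p∤n = units^e≡1⇒p∸1∣e pp (m ∸ 1) a^[m-1]≡1
  where
  instance _ = prime⇒nonZero pp
  a^[m-1]≡1 : ∀ a → 0 < a → a < p → (a ^ (m ∸ 1)) % p ≡ 1 % p
  a^[m-1]≡1 a@(suc a′) 0<a a<p =
    trans (%-cong-^ (m ∸ 1) (sym A≡a)) (carmichael-%∣ carm (∣m⇒∣m*n n ∣-refl) A A⊥m)
    where
    A : ℕ
    A = 1 + a′ * n ^ (p ∸ 1)
    A≡a : A % p ≡ a % p
    A≡a = %-cong-+ {p} {1} {1} refl
      (trans (%-cong-* {p} {a′} {a′} refl (fermat-∤ pp p∤n)) (cong (_% p) (*-identityʳ a′)))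
    p∤A : ¬ p ∣ A
    p∤A p∣A = <⇒≢ 0<a (sym (trans (sym (m<n⇒m%n≡m a<p)) (trans (sym A≡a) (n∣m⇒m%n≡0 A p p∣A))))
    n∣A-1 : n ∣ a′ * n ^ (p ∸ 1)
    n∣A-1 with p ∸ 1 in p∸1≡
    ... | zero  = ⊥-elim (<⇒≢ (m<n⇒0<n∸m (prime⇒>1 pp)) (sym p∸1≡))
    ... | suc j = ∣n⇒∣m*n a′ (∣m⇒∣m*n (n ^ j) ∣-refl)
    A⊥m : Coprime A (p * n)
    A⊥m = coprime-*ʳ (prime∤⇒coprime pp p∤A) (coprime-1+ n∣A-1)

[1+N]^e≡1+eN+jN² : ∀ N e → ∃ λ j → (1 + N) ^ e ≡ 1 + e * N + j * (N * N)
[1+N]^e≡1+eN+jN² N zero    = 0 , refl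
[1+N]^e≡1+eN+jN² N (suc e) with [1+N]^e≡1+eN+jN² N e
... | j , eq = j + e + j * N , trans (cong ((1 + N) *_) eq) (expand N e j)
  where
  expand : ∀ N e j → (1 + N) * (1 + e * N + j * (N * N)) ≡ 1 + (1 + e) * N + (j + e + j * N) * (N * N)
  expand = solve-∀

-- With m = x² y and N = x y, the base 1 + N gives (1 + N)^(m−1) ≡ 1 + (m − 1) N (mod m), forcing m ∣ N.
carmichael-squarefree : ∀ {m x} → Carmichael m → 1 < x → ¬ x * x ∣ m
carmichael-squarefree {m} {x} carm@(m-composite , fermat-m) 1<x (divides y m≡y*x*x) = <⇒≱ N<m (∣⇒≤ m∣N)
  where
  instance _ = composite⇒nonZero m-composite
  N : ℕ
  N = x * y
  m≡x*N : m ≡ x * N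
  m≡x*N = trans m≡y*x*x (reorder x y)
    where
    reorder : ∀ x y → y * (x * x) ≡ x * (x * y)
    reorder = solve-∀
  instance
    N≢0 : NonZero N
    N≢0 = ≢-nonZero λ N≡0 → ≢-nonZero⁻¹ m (trans m≡x*N (trans (cong (x *_) N≡0) (*-zeroʳ x)))
  N<m : N < m
  N<m = subst (N <_) (sym m≡x*N) (subst (_< x * N) (*-identityˡ N) (*-monoˡ-< N 1<x))
  1+N⊥m : Coprime (1 + N) m
  1+N⊥m = subst (Coprime (1 + N)) (sym m≡x*N) (coprime-*ʳ (coprime-1+ (m∣m*n {x} y)) (coprime-1+ ∣-refl))
  k : ℕ
  k = proj₁ (fermat-m (1 + N) 1+N⊥m)
  j : ℕ
  j = proj₁ ([1+N]^e≡1+eN+jN² N (m ∸ 1))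
  k*m≡ : k * m ≡ j * y * m + (m ∸ 1) * N
  k*m≡ = suc-injective (begin
    1 + k * m                               ≡⟨ proj₂ (fermat-m (1 + N) 1+N⊥m) ⟨
    (1 + N) ^ (m ∸ 1)                        ≡⟨ proj₂ ([1+N]^e≡1+eN+jN² N (m ∸ 1)) ⟩
    1 + (m ∸ 1) * N + j * (N * N)            ≡⟨ cong (λ z → 1 + (m ∸ 1) * N + j * z) N*N≡y*m ⟩
    1 + (m ∸ 1) * N + j * (y * m)            ≡⟨ reorder (m ∸ 1) N j y m ⟩
    1 + (j * y * m + (m ∸ 1) * N)            ∎)
    where
    open ≡-Reasoning
    N*N≡y*m : N * N ≡ y * m
    N*N≡y*m = trans (square x y) (cong (y *_) (sym m≡x*N))
      where
      square : ∀ x y → x * y * (x * y) ≡ y * (x * (x * y))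
      square = solve-∀
    reorder : ∀ a N j y m → 1 + a * N + j * (y * m) ≡ 1 + (j * y * m + a * N)
    reorder = solve-∀
  m∣[m-1]N : m ∣ (m ∸ 1) * N
  m∣[m-1]N = ∣m+n∣m⇒∣n (divides k (sym k*m≡)) (n∣m*n (j * y))
  m∣N : m ∣ N
  m∣N = ∣m+n∣m⇒∣n (subst (m ∣_) (sym [m-1]N+N≡N*m) (m∣m*n N)) m∣[m-1]N
    where
    [m-1]N+N≡N*m : (m ∸ 1) * N + N ≡ m * N
    [m-1]N+N≡N*m = trans (cong ((m ∸ 1) * N +_) (sym (*-identityˡ N)))
      (trans (sym (*-distribʳ-+ N (m ∸ 1) 1)) (cong (_* N) (m∸n+n≡m (>-nonZero⁻¹ m))))

prime∣prime⇒≡ : ∀ {p q} → Prime p → Prime q → p ∣ q → p ≡ q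
prime∣prime⇒≡ pp pq p∣q with prime⇒irreducible pq p∣q
... | inj₁ refl = ⊥-elim (<-irrefl refl (prime⇒>1 pp))
... | inj₂ p≡q  = p≡q

prime∣^⇒∣ : ∀ {p} a e → Prime p → p ∣ a ^ e → p ∣ a
prime∣^⇒∣ a zero    pp p∣1 = ⊥-elim (<⇒≱ (prime⇒>1 pp) (∣⇒≤ p∣1))
prime∣^⇒∣ a (suc e) pp p∣a^e with euclidsLemma a (a ^ e) pp p∣a^e
... | inj₁ p∣a     = p∣a
... | inj₂ p∣a^e′  = prime∣^⇒∣ a e pp p∣a^e′

prime∣product⇒∃ : ∀ {q} {A : Set} {P : A → Set} (f : A → ℕ) → Prime q → ∀ {xs} → All P xs →
                  q ∣ product (map f xs) → ∃ λ x → P x × q ∣ f x × f x ∣ product (map f xs)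
prime∣product⇒∃ f pq {[]}     []         q∣1 = ⊥-elim (<⇒≱ (prime⇒>1 pq) (∣⇒≤ q∣1))
prime∣product⇒∃ f pq {x ∷ xs} (px ∷ pxs) q∣∏ with euclidsLemma (f x) (product (map f xs)) pq q∣∏
... | inj₁ q∣fx = x , px , q∣fx , m∣m*n _
... | inj₂ q∣∏′ with prime∣product⇒∃ f pq pxs q∣∏′
...   | y , py , q∣fy , fy∣∏ = y , py , q∣fy , ∣n⇒∣m*n (f x) fy∣∏

∣p*n⇒ : ∀ {p n g} → Prime p → g ∣ p * n → g ∣ n ⊎ ∃ λ h → g ≡ p * h × h ∣ n
∣p*n⇒ {p} {n} {g} pp g∣pn with p ∣? g
... | yes (divides h g≡h*p) = inj₂ (h , trans g≡h*p (*-comm h p) ,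
                                      *-cancelˡ-∣ p {{prime⇒nonZero pp}} (subst (_∣ p * n) (trans g≡h*p (*-comm h p)) g∣pn))
... | no p∤g = inj₁ (coprime-divisor (prime∤⇒coprime pp p∤g) g∣pn)

-- Digit sums

private
  digitSumAux-0 : ∀ f k → digitSumAux f k 0 ≡ 0
  digitSumAux-0 zero    k = refl
  digitSumAux-0 (suc f) k = digitSumAux-0 f k

  digitSumAux-fuel : ∀ k {n} f f′ → n ≤ f → n ≤ f′ → digitSumAux f k n ≡ digitSumAux f′ k n
  digitSumAux-fuel k {zero}  f       f′       _   _    = trans (digitSumAux-0 f k) (sym (digitSumAux-0 f′ k))
  digitSumAux-fuel k {suc n} (suc f) (suc f′) n≤f n≤f′ =
    cong (suc n % suc (suc k) +_) (digitSumAux-fuel k f f′ (≤-pred (<-≤-trans n/g<n n≤f)) (≤-pred (<-≤-trans n/g<n n≤f′)))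
    where
    n/g<n : suc n / suc (suc k) < suc n
    n/g<n = m/n<m (suc n) (suc (suc k)) (s≤s (s≤s z≤n))

s-0 : ∀ g → s g 0 ≡ 0
s-0 zero          = refl
s-0 (suc zero)    = refl
s-0 (suc (suc k)) = refl

s-unfold : ∀ {g} .{{_ : NonZero g}} → 1 < g → ∀ n → s g n ≡ n % g + s g (n / g)
s-unfold {suc zero} (s≤s ())
s-unfold {suc (suc k)} _ zero    = refl
s-unfold {g@(suc (suc k))} _ (suc n) =
  cong (suc n % g +_) (digitSumAux-fuel k n (suc n / g) (≤-pred (m/n<m (suc n) g (s≤s (s≤s z≤n)))) ≤-refl)

module _ {g : ℕ} (1<g : 1 < g) where

  private instance
    g≢0 : NonZero g
    g≢0 = >-nonZero (<-trans z<s 1<g)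

  s-digit : ∀ {c} n → c < g → s g (c + n * g) ≡ c + s g n
  s-digit {c} n c<g = begin
    s g (c + n * g)                                   ≡⟨ s-unfold 1<g (c + n * g) ⟩
    (c + n * g) % g + s g ((c + n * g) / g)           ≡⟨ cong₂ (λ x y → x + s g y) c+ng%g≡c c+ng/g≡n ⟩
    c + s g n                                         ∎
    where
    open ≡-Reasoning
    c+ng%g≡c : (c + n * g) % g ≡ c
    c+ng%g≡c = trans ([m+kn]%n≡m%n c n g) (m<n⇒m%n≡m c<g)
    c+ng/g≡n : (c + n * g) / g ≡ n
    c+ng/g≡n = trans (+-distrib-/-∣ʳ c (n∣m*n n)) (cong₂ _+_ (m<n⇒m/n≡0 c<g) (m*n/n≡m n g))

  s-threeDigits : ∀ {a b c} → a < g → b < g → c < g → s g (g * (a * g * g + b * g + c)) ≡ a + b + c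
  s-threeDigits {a} {b} {c} a<g b<g c<g = begin
    s g (g * (a * g * g + b * g + c))               ≡⟨ cong (s g) (horner g a b c) ⟩
    s g (0 + (c + (b + (a + 0 * g) * g) * g) * g)   ≡⟨ s-digit _ (<-trans z<s 1<g) ⟩
    s g (c + (b + (a + 0 * g) * g) * g)             ≡⟨ s-digit _ c<g ⟩
    c + s g (b + (a + 0 * g) * g)                   ≡⟨ cong (c +_) (s-digit _ b<g) ⟩
    c + (b + s g (a + 0 * g))                       ≡⟨ cong (λ z → c + (b + z)) (s-digit 0 a<g) ⟩
    c + (b + (a + s g 0))                           ≡⟨ cong (λ z → c + (b + (a + z))) (s-0 g) ⟩
    c + (b + (a + 0))                               ≡⟨ reorder a b c ⟩
    a + b + c                                       ∎
    where
    open ≡-Reasoning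
    horner : ∀ g a b c → g * (a * g * g + b * g + c) ≡ 0 + (c + (b + (a + 0 * g) * g) * g) * g
    horner = solve-∀
    reorder : ∀ a b c → c + (b + (a + 0)) ≡ a + b + c
    reorder = solve-∀

  s≡[mod-g∸1] : ∀ n → ∃ λ C → n ≡ s g n + (g ∸ 1) * C
  s≡[mod-g∸1] = <-rec _ step
    where
    step : ∀ n → (∀ {m} → m < n → ∃ λ C → m ≡ s g m + (g ∸ 1) * C) → ∃ λ C → n ≡ s g n + (g ∸ 1) * C
    step zero    _  = 0 , cong₂ _+_ (sym (s-0 g)) (sym (*-zeroʳ (g ∸ 1)))
    step n@(suc _) ih with ih (m/n<m n g 1<g)
    ... | C , q≡ = C + n / g , (begin
      n                                                    ≡⟨ m≡m%n+[m/n]*n n g ⟩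
      n % g + n / g * g                                    ≡⟨ cong (n % g +_) (split (n / g)) ⟩
      n % g + (n / g + (g ∸ 1) * (n / g))                  ≡⟨ cong (λ z → n % g + (z + (g ∸ 1) * (n / g))) q≡ ⟩
      n % g + (s g (n / g) + (g ∸ 1) * C + (g ∸ 1) * (n / g)) ≡⟨ regroup (n % g) (s g (n / g)) (g ∸ 1) C (n / g) ⟩
      n % g + s g (n / g) + (g ∸ 1) * (C + n / g)          ≡⟨ cong (_+ (g ∸ 1) * (C + n / g)) (s-unfold 1<g n) ⟨
      s g n + (g ∸ 1) * (C + n / g)                        ∎)
      where
      open ≡-Reasoning
      split : ∀ q → q * g ≡ q + (g ∸ 1) * q
      split q = trans (cong (q *_) (sym (suc-pred g))) (trans (*-suc q (g ∸ 1)) (cong (q +_) (*-comm q (g ∸ 1))))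
      regroup : ∀ a b h c d → a + (b + h * c + h * d) ≡ a + b + h * (c + d)
      regroup = solve-∀

  s≡0⇒≡0 : ∀ n → s g n ≡ 0 → n ≡ 0
  s≡0⇒≡0 = <-rec _ step
    where
    step : ∀ n → (∀ {m} → m < n → s g m ≡ 0 → m ≡ 0) → s g n ≡ 0 → n ≡ 0
    step zero      _  _    = refl
    step n@(suc _) ih sn≡0 = begin
      n                  ≡⟨ m≡m%n+[m/n]*n n g ⟩
      n % g + n / g * g  ≡⟨ cong₂ (λ r q → r + q * g) (m+n≡0⇒m≡0 (n % g) digits≡0) (ih (m/n<m n g 1<g) (m+n≡0⇒n≡0 (n % g) digits≡0)) ⟩
      0                  ∎
      where
      open ≡-Reasoning
      digits≡0 : n % g + s g (n / g) ≡ 0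
      digits≡0 = trans (sym (s-unfold 1<g n)) sn≡0

  s≡1⇒≡g^j : ∀ n → s g n ≡ 1 → ∃ λ j → n ≡ g ^ j
  s≡1⇒≡g^j = <-rec _ step
    where
    step : ∀ n → (∀ {m} → m < n → s g m ≡ 1 → ∃ λ j → m ≡ g ^ j) → s g n ≡ 1 → ∃ λ j → n ≡ g ^ j
    step zero      _  s0≡1 = ⊥-elim (0≢1+n (trans (sym (s-0 g)) s0≡1))
    step n@(suc _) ih sn≡1 with n % g | s g (n / g) in s[n/g]≡ | m≡m%n+[m/n]*n n g | trans (sym (s-unfold 1<g n)) sn≡1
    ... | zero        | _    | n≡ | w≡1 with ih (m/n<m n g 1<g) (trans s[n/g]≡ w≡1)
    ...   | j , n/g≡g^j = suc j , trans n≡ (trans (cong (_* g) n/g≡g^j) (*-comm (g ^ j) g))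
    step n@(suc _) ih sn≡1 | suc zero    | zero | n≡ | _ =
      0 , trans n≡ (cong (λ q → 1 + q * g) (s≡0⇒≡0 (n / g) s[n/g]≡))
    step n@(suc _) ih sn≡1 | suc zero    | suc _ | _ | ()
    step n@(suc _) ih sn≡1 | suc (suc _) | _     | _ | ()

  g≤s : ∀ {m} → 0 < m → g ∸ 1 ∣ m ∸ 1 → ¬ (∃ λ j → m ≡ g ^ j) → g ≤ s g m
  g≤s {m} 0<m g-1∣m-1 m≢g^j with s g m in sm≡ | s≡[mod-g∸1] m
  ... | zero          | _      = ⊥-elim (<⇒≢ 0<m (sym (s≡0⇒≡0 m sm≡)))
  ... | suc zero      | _      = ⊥-elim (m≢g^j (s≡1⇒≡g^j m sm≡))
  ... | suc (suc d)   | C , m≡ = subst (_≤ suc (suc d)) (suc-pred g) (s≤s (∣⇒≤ g-1∣1+d))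
    where
    g-1∣1+d : g ∸ 1 ∣ suc d
    g-1∣1+d = ∣m+n∣m⇒∣n (subst (g ∸ 1 ∣_) (trans (cong (_∸ 1) m≡) (+-comm (suc d) _)) g-1∣m-1) (m∣m*n C)

  s[g*c]≡c : ∀ {c} → c < g → s g (g * c) ≡ c
  s[g*c]≡c {c} c<g = begin
    s g (g * c)        ≡⟨ cong (s g) (*-comm g c) ⟩
    s g (0 + c * g)    ≡⟨ s-digit c (<-trans z<s 1<g) ⟩
    s g c              ≡⟨ cong (s g) (+-identityʳ c) ⟨
    s g (c + 0 * g)    ≡⟨ s-digit 0 c<g ⟩
    c + s g 0          ≡⟨ cong (c +_) (s-0 g) ⟩
    c + 0              ≡⟨ +-identityʳ c ⟩
    c                  ∎
    where open ≡-Reasoning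

s-self : ∀ {P N} a b c → 1 < P → a < P → b < P → c < P →
         N ≡ a * P * P + b * P + c → a + b + c ≡ P → s P (P * N) ≡ P
s-self {P} a b c 1<P a<P b<P c<P refl a+b+c≡P = trans (s-threeDigits 1<P a<P b<P c<P) a+b+c≡P

-- (xu + 1)(yu + 1) = (K − 1) P + (P − K + 1) in base P = ru + 1.
s-self-twoDigits : ∀ {r x y u K} → 0 < u → x ≤ r → y < r → 2 ≤ K → r * K ≡ x * y * u + x + y →
                   s (r * u + 1) ((r * u + 1) * ((x * u + 1) * (y * u + 1))) ≡ r * u + 1
s-self-twoDigits {r} {x} {y} {u} {K@(suc b)} 0<u x≤r y<r (s≤s 1≤b) rK≡ =
  s-self 0 b c 1<P 0<P b<P c<P N≡ (trans (+-comm b c) c+b≡P)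
  where
  P : ℕ
  P = r * u + 1
  1<P : 1 < P
  1<P = subst (1 <_) (+-comm 1 (r * u)) (s≤s (*-mono-≤ (<-≤-trans z<s y<r) 0<u))
  0<P : 0 < P
  0<P = <-trans z<s 1<P
  instance _ = >-nonZero (<-≤-trans z<s y<r)
  rK≤rP : r * K ≤ r * P
  rK≤rP = begin
    r * K                      ≡⟨ rK≡ ⟩
    x * y * u + x + y          ≤⟨ +-monoˡ-≤ y (+-monoʳ-≤ (x * y * u) (m≤m*n x u {{>-nonZero 0<u}})) ⟩
    x * y * u + x * u + y      ≡⟨ cong (_+ y) (factor x y u) ⟩
    x * (1 + y) * u + y        ≤⟨ +-mono-≤ (*-monoˡ-≤ u (*-mono-≤ x≤r y<r)) (<⇒≤ y<r) ⟩
    r * r * u + r              ≡⟨ factor′ r u ⟩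
    r * P                      ∎
    where
    open ≤-Reasoning
    factor : ∀ x y u → x * y * u + x * u ≡ x * (1 + y) * u
    factor = solve-∀
    factor′ : ∀ r u → r * r * u + r ≡ r * (r * u + 1)
    factor′ = solve-∀
  b<P : b < P
  b<P = *-cancelˡ-≤ r rK≤rP
  c : ℕ
  c = P ∸ b
  c+b≡P : c + b ≡ P
  c+b≡P = m∸n+n≡m (<⇒≤ b<P)
  c<P : c < P
  c<P = subst (c <_) c+b≡P (subst (_≤ c + b) (+-comm c 1) (+-monoʳ-≤ c 1≤b))
  N≡ : (x * u + 1) * (y * u + 1) ≡ 0 * P * P + b * P + c
  N≡ = +-cancelʳ-≡ b _ _ (begin
    (x * u + 1) * (y * u + 1) + b    ≡⟨ expand x y u b ⟩
    u * (x * y * u + x + y) + K      ≡⟨ cong (λ z → u * z + K) rK≡ ⟨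
    u * (r * K) + K                  ≡⟨ regroup b r u ⟩
    b * P + P                        ≡⟨ cong (b * P +_) c+b≡P ⟨
    b * P + (c + b)                  ≡⟨ +-assoc (b * P) c b ⟨
    0 * P * P + b * P + c + b        ∎)
    where
    open ≡-Reasoning
    expand : ∀ x y u b → (x * u + 1) * (y * u + 1) + b ≡ u * (x * y * u + x + y) + suc b
    expand = solve-∀
    regroup : ∀ b r u → u * (r * suc b) + suc b ≡ b * (r * u + 1) + (r * u + 1)
    regroup = solve-∀

-- Writing xy = a r² + b with 0 < b < r² and b u + x + y = w r, the base-(ru + 1) digits of
-- (xu + 1)(yu + 1) are a, w − 2a − 1 and ru + 2 + a − w.
module _ {r x y u : ℕ} (1<r : 1 < r) (0<x : 0 < x) (0<y : 0 < y) (1<xy : 1 < x * y)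
         (r∤xy : ¬ r ∣ x * y) (r∣xyu+x+y : r ∣ x * y * u + x + y) (r*xy≤u : r * (x * y) ≤ u) where

  private
    P xy a b : ℕ
    P = r * u + 1
    xy = x * y
    instance
      r≢0 : NonZero r
      r≢0 = >-nonZero (<-trans z<s 1<r)
      r*r≢0 : NonZero (r * r)
      r*r≢0 = m*n≢0 r r
    a = xy / (r * r)
    b = xy % (r * r)

    xy≡b+a*r*r : xy ≡ b + a * (r * r)
    xy≡b+a*r*r = m≡m%n+[m/n]*n xy (r * r)

    0<b : 0 < b
    0<b = n≢0⇒n>0 λ b≡0 → r∤xy (divides (a * r) (trans xy≡b+a*r*r (trans (cong (_+ a * (r * r)) b≡0) (sym (*-assoc a r r)))))

    r∣bu+x+y : r ∣ b * u + x + y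
    r∣bu+x+y = ∣m+n∣m⇒∣n (subst (r ∣_) (split a r u b x y) (subst (λ z → r ∣ z * u + x + y) xy≡b+a*r*r r∣xyu+x+y))
                         (n∣m*n (a * r * u))
      where
      split : ∀ a r u b x y → (b + a * (r * r)) * u + x + y ≡ a * r * u * r + (b * u + x + y)
      split = solve-∀

    w : ℕ
    w = quotient r∣bu+x+y

    w*r≡ : b * u + x + y ≡ w * r
    w*r≡ = _∣_.equality r∣bu+x+y

    x+y≤u : x + y ≤ u
    x+y≤u = begin
      x + y          ≤⟨ +-mono-≤ (m≤m*n x y {{>-nonZero 0<y}}) (m≤n*m y x {{>-nonZero 0<x}}) ⟩
      xy + xy        ≡⟨ cong (xy +_) (+-identityʳ xy) ⟨
      2 * xy         ≤⟨ *-monoˡ-≤ xy 1<r ⟩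
      r * xy         ≤⟨ r*xy≤u ⟩
      u              ∎
      where open ≤-Reasoning

    xy≤w : xy ≤ w
    xy≤w = *-cancelʳ-≤ xy w r (begin
      xy * r           ≡⟨ *-comm xy r ⟩
      r * xy           ≤⟨ r*xy≤u ⟩
      u                ≤⟨ m≤n*m u b {{>-nonZero 0<b}} ⟩
      b * u            ≤⟨ ≤-trans (m≤m+n (b * u) x) (m≤m+n (b * u + x) y) ⟩
      b * u + x + y    ≡⟨ w*r≡ ⟩
      w * r            ∎)
      where open ≤-Reasoning

    w≤ru : w ≤ r * u
    w≤ru = *-cancelʳ-≤ w (r * u) r (begin
      w * r               ≡⟨ w*r≡ ⟨
      b * u + x + y       ≡⟨ +-assoc (b * u) x y ⟩
      b * u + (x + y)     ≤⟨ +-monoʳ-≤ (b * u) x+y≤u ⟩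
      b * u + u           ≡⟨ +-comm (b * u) u ⟩
      suc b * u           ≤⟨ *-monoˡ-≤ u (m%n<n xy (r * r)) ⟩
      r * r * u           ≡⟨ trans (*-assoc r r u) (*-comm r (r * u)) ⟩
      r * u * r           ∎)
      where open ≤-Reasoning

    2a+2≤xy : 2 * a + 2 ≤ xy
    2a+2≤xy with a | xy≡b+a*r*r
    ... | zero   | _  = 1<xy
    ... | suc a′ | xy≡ = begin
      2 * suc a′ + 2           ≤⟨ bound a′ ⟩
      1 + suc a′ * 4           ≤⟨ +-mono-≤ 0<b (*-monoʳ-≤ (suc a′) (*-mono-≤ 1<r 1<r)) ⟩
      b + suc a′ * (r * r)     ≡⟨ xy≡ ⟨
      xy                       ∎
      where
      open ≤-Reasoning
      bound : ∀ a′ → 2 * suc a′ + 2 ≤ 1 + suc a′ * 4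
      bound a′ = subst₂ _≤_ (lhs a′) (rhs a′) (m≤n+m (4 + 2 * a′) (1 + 2 * a′))
        where
        lhs : ∀ a′ → 4 + 2 * a′ ≡ 2 * suc a′ + 2
        lhs = solve-∀
        rhs : ∀ a′ → 1 + 2 * a′ + (4 + 2 * a′) ≡ 1 + suc a′ * 4
        rhs = solve-∀

    B : ℕ
    B = w ∸ (2 * a + 1)

    B+2a+1≡w : B + (2 * a + 1) ≡ w
    B+2a+1≡w = m∸n+n≡m (≤-trans (+-monoʳ-≤ (2 * a) (s≤s z≤n)) (≤-trans 2a+2≤xy xy≤w))

    C : ℕ
    C = (r * u + 2 + a) ∸ w

    C+w≡ : C + w ≡ r * u + 2 + a
    C+w≡ = m∸n+n≡m (≤-trans w≤ru (≤-trans (m≤m+n (r * u) 2) (m≤m+n (r * u + 2) a)))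

    ru<P : r * u < P
    ru<P = m<m+n (r * u) z<s

    u≤ru : u ≤ r * u
    u≤ru = m≤n*m u r

    1<P : 1 < P
    1<P = subst (1 <_) (+-comm 1 (r * u)) (s≤s (≤-trans (≤-trans (<-trans z<s 1<xy) (m≤n*m xy r)) (≤-trans r*xy≤u u≤ru)))

    a<P : a < P
    a<P = ≤-<-trans (≤-trans (m/n≤m xy (r * r)) (≤-trans (m≤n*m xy r) (≤-trans r*xy≤u u≤ru))) ru<P

    B<P : B < P
    B<P = ≤-<-trans (≤-trans (m∸n≤m w (2 * a + 1)) w≤ru) ru<P

    C<P : C < P
    C<P = ≤-<-trans (+-cancelʳ-≤ (a + 2) C (r * u) (begin
      C + (a + 2)        ≤⟨ +-monoʳ-≤ C a+2≤w ⟩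
      C + w              ≡⟨ C+w≡ ⟩
      r * u + 2 + a      ≡⟨ +-assoc (r * u) 2 a ⟩
      r * u + (2 + a)    ≡⟨ cong (r * u +_) (+-comm 2 a) ⟩
      r * u + (a + 2)    ∎)) ru<P
      where
      open ≤-Reasoning
      a+2≤w : a + 2 ≤ w
      a+2≤w = ≤-trans (+-monoˡ-≤ 2 (m≤m+n a (a + 0))) (≤-trans 2a+2≤xy xy≤w)

    N≡ : (x * u + 1) * (y * u + 1) ≡ a * P * P + B * P + C
    N≡ = +-cancelʳ-≡ w _ _ (begin
      (x * u + 1) * (y * u + 1) + w                                 ≡⟨ expand x y u w ⟩
      x * y * u * u + (x + y) * u + 1 + w                           ≡⟨ cong (λ z → z * u * u + (x + y) * u + 1 + w) xy≡b+a*r*r ⟩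
      (b + a * (r * r)) * u * u + (x + y) * u + 1 + w               ≡⟨ regroup a (r * r) u b x y w ⟩
      a * (r * r) * u * u + u * (b * u + x + y) + w + 1             ≡⟨ cong (λ z → a * (r * r) * u * u + u * z + w + 1) w*r≡ ⟩
      a * (r * r) * u * u + u * (w * r) + w + 1                     ≡⟨ cong (λ z → a * (r * r) * u * u + u * (z * r) + z + 1) B+2a+1≡w ⟨
      a * (r * r) * u * u + u * ((B + (2 * a + 1)) * r) + (B + (2 * a + 1)) + 1 ≡⟨ digits a B r u ⟩
      a * P * P + B * P + (r * u + 2 + a)                           ≡⟨ cong (a * P * P + B * P +_) C+w≡ ⟨
      a * P * P + B * P + (C + w)                                   ≡⟨ +-assoc (a * P * P + B * P) C w ⟨
      a * P * P + B * P + C + w                                     ∎)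
      where
      open ≡-Reasoning
      expand : ∀ x y u w → (x * u + 1) * (y * u + 1) + w ≡ x * y * u * u + (x + y) * u + 1 + w
      expand = solve-∀
      regroup : ∀ a rr u b x y w → (b + a * rr) * u * u + (x + y) * u + 1 + w ≡ a * rr * u * u + u * (b * u + x + y) + w + 1
      regroup = solve-∀
      digits : ∀ a B r u → a * (r * r) * u * u + u * ((B + (2 * a + 1)) * r) + (B + (2 * a + 1)) + 1
                         ≡ a * (r * u + 1) * (r * u + 1) + B * (r * u + 1) + (r * u + 2 + a)
      digits = solve-∀

    a+B+C≡P : a + B + C ≡ P
    a+B+C≡P = +-cancelʳ-≡ (a + 1) _ _ (begin
      a + B + C + (a + 1)     ≡⟨ regroup a B C ⟩
      B + (2 * a + 1) + C     ≡⟨ cong (_+ C) B+2a+1≡w ⟩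
      w + C                   ≡⟨ +-comm w C ⟩
      C + w                   ≡⟨ C+w≡ ⟩
      r * u + 2 + a           ≡⟨ regroup′ (r * u) a ⟩
      r * u + 1 + (a + 1)     ∎)
      where
      open ≡-Reasoning
      regroup : ∀ a B C → a + B + C + (a + 1) ≡ B + (2 * a + 1) + C
      regroup = solve-∀
      regroup′ : ∀ x a → x + 2 + a ≡ x + 1 + (a + 1)
      regroup′ = solve-∀

  s-self-threeDigits : s (r * u + 1) ((r * u + 1) * ((x * u + 1) * (y * u + 1))) ≡ r * u + 1
  s-self-threeDigits = s-self a B C 1<P a<P B<P C<P N≡ a+B+C≡P

-- The base-(u + 1) digits of (xu + 1)(yu + 1) are xy − 1, u + x + y + 1 − 2xy and xy + 1 − x − y.
module _ {x y u : ℕ} (0<x : 0 < x) (0<y : 0 < y) (x+y<xy : x + y < x * y) (2xy≤ : 2 * (x * y) ≤ u + x + y + 1) where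

  private
    P xy a B C : ℕ
    P = u + 1
    xy = x * y
    a = xy ∸ 1
    B = (u + x + y + 1) ∸ 2 * xy
    C = (xy + 1) ∸ (x + y)

    0<xy : 0 < xy
    0<xy = <-≤-trans z<s x+y<xy

    a+1≡xy : a + 1 ≡ xy
    a+1≡xy = m∸n+n≡m 0<xy

    B+2xy≡ : B + 2 * xy ≡ u + x + y + 1
    B+2xy≡ = m∸n+n≡m 2xy≤

    C+x+y≡ : C + (x + y) ≡ xy + 1
    C+x+y≡ = m∸n+n≡m (≤-trans (<⇒≤ x+y<xy) (m≤m+n xy 1))

    xy≤u : xy ≤ u
    xy≤u = +-cancelʳ-≤ xy xy u (begin
      xy + xy               ≡⟨ cong (xy +_) (+-identityʳ xy) ⟨
      2 * xy                ≤⟨ 2xy≤ ⟩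
      u + x + y + 1         ≡⟨ regroup u x y ⟩
      u + (x + y + 1)       ≤⟨ +-monoʳ-≤ u (≤-reflexive (+-comm (x + y) 1)) ⟩
      u + suc (x + y)       ≤⟨ +-monoʳ-≤ u x+y<xy ⟩
      u + xy                ∎)
      where
      open ≤-Reasoning
      regroup : ∀ u x y → u + x + y + 1 ≡ u + (x + y + 1)
      regroup = solve-∀

    u<P : u < P
    u<P = m<m+n u z<s

    a<P : a < P
    a<P = ≤-<-trans (≤-trans (m∸n≤m xy 1) xy≤u) u<P

    B<P : B < P
    B<P = +-cancelʳ-< (2 * xy) B P (begin-strict
      B + 2 * xy         ≡⟨ B+2xy≡ ⟩
      u + x + y + 1      ≡⟨ regroup u x y ⟩
      P + (x + y)        <⟨ +-monoʳ-< P (<-≤-trans x+y<xy (m≤m+n xy (xy + 0))) ⟩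
      P + 2 * xy         ∎)
      where
      open ≤-Reasoning
      regroup : ∀ u x y → u + x + y + 1 ≡ u + 1 + (x + y)
      regroup = solve-∀

    C<P : C < P
    C<P = ≤-<-trans (+-cancelʳ-≤ 2 C a (begin
      C + 2              ≤⟨ +-monoʳ-≤ C (+-mono-≤ 0<x 0<y) ⟩
      C + (x + y)        ≡⟨ C+x+y≡ ⟩
      xy + 1             ≡⟨ cong (_+ 1) a+1≡xy ⟨
      a + 1 + 1          ≡⟨ +-assoc a 1 1 ⟩
      a + 2              ∎)) a<P
      where open ≤-Reasoning

    1<P : 1 < P
    1<P = subst (1 <_) (+-comm 1 u) (s≤s (≤-trans 0<xy xy≤u))

    N≡ : (x * u + 1) * (y * u + 1) ≡ a * P * P + B * P + C
    N≡ = +-cancelʳ-≡ (P * P + 2 * xy * P + (x + y)) _ _ (begin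
      (x * u + 1) * (y * u + 1) + (P * P + 2 * xy * P + (x + y))     ≡⟨ expand x y u ⟩
      xy * P * P + (u + x + y + 1) * P + (xy + 1)                    ≡⟨ cong₂ (λ z w → z * P * P + w * P + (xy + 1)) a+1≡xy B+2xy≡ ⟨
      (a + 1) * P * P + (B + 2 * xy) * P + (xy + 1)                  ≡⟨ cong ((a + 1) * P * P + (B + 2 * xy) * P +_) C+x+y≡ ⟨
      (a + 1) * P * P + (B + 2 * xy) * P + (C + (x + y))             ≡⟨ regroup a B C P xy (x + y) ⟩
      a * P * P + B * P + C + (P * P + 2 * xy * P + (x + y))         ∎)
      where
      open ≡-Reasoning
      expand : ∀ x y u → (x * u + 1) * (y * u + 1) + ((u + 1) * (u + 1) + 2 * (x * y) * (u + 1) + (x + y))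
                       ≡ x * y * (u + 1) * (u + 1) + (u + x + y + 1) * (u + 1) + (x * y + 1)
      expand = solve-∀
      regroup : ∀ a B C P xy s → (a + 1) * P * P + (B + 2 * xy) * P + (C + s) ≡ a * P * P + B * P + C + (P * P + 2 * xy * P + s)
      regroup = solve-∀

    a+B+C≡P : a + B + C ≡ P
    a+B+C≡P = +-cancelʳ-≡ (1 + 2 * xy + (x + y)) _ _ (begin
      a + B + C + (1 + 2 * xy + (x + y))       ≡⟨ regroup a B C xy (x + y) ⟩
      (a + 1) + (B + 2 * xy) + (C + (x + y))   ≡⟨ cong₂ (λ z w → z + w + (C + (x + y))) a+1≡xy B+2xy≡ ⟩
      xy + (u + x + y + 1) + (C + (x + y))     ≡⟨ cong (xy + (u + x + y + 1) +_) C+x+y≡ ⟩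
      xy + (u + x + y + 1) + (xy + 1)          ≡⟨ regroup′ u x y ⟩
      u + 1 + (1 + 2 * xy + (x + y))           ∎)
      where
      open ≡-Reasoning
      regroup : ∀ a B C xy s → a + B + C + (1 + 2 * xy + s) ≡ (a + 1) + (B + 2 * xy) + (C + s)
      regroup = solve-∀
      regroup′ : ∀ u x y → x * y + (u + x + y + 1) + (x * y + 1) ≡ u + 1 + (1 + 2 * (x * y) + (x + y))
      regroup′ = solve-∀

  s-self-threeDigits-r≡1 : s (u + 1) ((u + 1) * ((x * u + 1) * (y * u + 1))) ≡ u + 1
  s-self-threeDigits-r≡1 = s-self a B C 1<P a<P B<P C<P N≡ a+B+C≡P

-- Carmichael numbers with three prime factors

coprime⇒*∣ : ∀ {a b n} → Coprime a b → a ∣ n → b ∣ n → a * b ∣ n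
coprime⇒*∣ {a} {b} {n} a⊥b (divides q n≡q*a) b∣n = divides q′ (begin
  n          ≡⟨ n≡q*a ⟩
  q * a      ≡⟨ cong (_* a) q≡q′*b ⟩
  q′ * b * a ≡⟨ *-assoc q′ b a ⟩
  q′ * (b * a) ≡⟨ cong (q′ *_) (*-comm b a) ⟩
  q′ * (a * b) ∎)
  where
  open ≡-Reasoning
  b∣q : b ∣ q
  b∣q = coprime-divisor (coprime-sym a⊥b) (subst (b ∣_) (trans n≡q*a (*-comm q a)) b∣n)
  q′ : ℕ
  q′ = quotient b∣q
  q≡q′*b : q ≡ q′ * b
  q≡q′*b = _∣_.equality b∣q

-- If p = ru + 1, q = au + 1, q′ = bu + 1 then pqq′ − 1 = ru·qq′ + u(abu + a + b).
korselt-cofactor : ∀ {r a b u} → 0 < u → r * u ∣ (r * u + 1) * ((a * u + 1) * (b * u + 1)) ∸ 1 → r ∣ a * b * u + a + b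
korselt-cofactor {r} {a} {b} {u} 0<u ru∣ =
  *-cancelʳ-∣ u {{>-nonZero 0<u}} (∣m+n∣m⇒∣n (subst (r * u ∣_) expand ru∣) (n∣m*n ((a * u + 1) * (b * u + 1))))
  where
  expand : (r * u + 1) * ((a * u + 1) * (b * u + 1)) ∸ 1 ≡ (a * u + 1) * (b * u + 1) * (r * u) + (a * b * u + a + b) * u
  expand = cong (_∸ 1) (lemma r a b u)
    where
    lemma : ∀ r a b u → (r * u + 1) * ((a * u + 1) * (b * u + 1)) ≡ 1 + ((a * u + 1) * (b * u + 1) * (r * u) + (a * b * u + a + b) * u)
    lemma = solve-∀

∣Y⇒∣ : ∀ {d a b c u} → d ∣ a → a ∣ b * c * u + b + c → d ∣ b → d ∣ c
∣Y⇒∣ {u = u} d∣a a∣Y d∣b = ∣m+n∣m⇒∣n (∣-trans d∣a a∣Y) (∣m∣n⇒∣m+n (∣m⇒∣m*n u (∣m⇒∣m*n _ d∣b)) d∣b)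

Y-comm : ∀ b c u → b * c * u + b + c ≡ c * b * u + c + b
Y-comm = solve-∀

σ₃∣uσ₂+σ₁ : ∀ {r₁ r₂ r₃ u} → Coprime r₁ r₂ → Coprime r₁ r₃ → Coprime r₂ r₃ →
            r₁ ∣ r₂ * r₃ * u + r₂ + r₃ → r₂ ∣ r₁ * r₃ * u + r₁ + r₃ → r₃ ∣ r₁ * r₂ * u + r₁ + r₂ →
            σ₃ r₁ r₂ r₃ ∣ u * σ₂ r₁ r₂ r₃ + σ₁ r₁ r₂ r₃
σ₃∣uσ₂+σ₁ {r₁} {r₂} {r₃} {u} c₁₂ c₁₃ c₂₃ r₁∣ r₂∣ r₃∣ =
  coprime⇒*∣ (coprime-sym (coprime-*ʳ (coprime-sym c₁₃) (coprime-sym c₂₃))) (coprime⇒*∣ c₁₂ r₁∣Z r₂∣Z) r₃∣Z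
  where
  Z : ℕ
  Z = u * σ₂ r₁ r₂ r₃ + σ₁ r₁ r₂ r₃
  r₁∣Z : r₁ ∣ Z
  r₁∣Z = subst (r₁ ∣_) (split r₁ r₂ r₃ u) (∣m∣n⇒∣m+n (m∣m*n _) r₁∣)
    where
    split : ∀ a b c u → a * (b * u + c * u + 1) + (b * c * u + b + c) ≡ u * (a * b + a * c + b * c) + (a + b + c)
    split = solve-∀
  r₂∣Z : r₂ ∣ Z
  r₂∣Z = subst (r₂ ∣_) (split r₁ r₂ r₃ u) (∣m∣n⇒∣m+n (m∣m*n _) r₂∣)
    where
    split : ∀ a b c u → b * (a * u + c * u + 1) + (a * c * u + a + c) ≡ u * (a * b + a * c + b * c) + (a + b + c)
    split = solve-∀
  r₃∣Z : r₃ ∣ Z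
  r₃∣Z = subst (r₃ ∣_) (split r₁ r₂ r₃ u) (∣m∣n⇒∣m+n (m∣m*n _) r₃∣)
    where
    split : ∀ a b c u → c * (a * u + b * u + 1) + (a * b * u + a + b) ≡ u * (a * b + a * c + b * c) + (a + b + c)
    split = solve-∀

isEll-% : ∀ {r₁ r₂ r₃} u .{{_ : NonZero (σ₃ r₁ r₂ r₃)}} → σ₃ r₁ r₂ r₃ ∣ u * σ₂ r₁ r₂ r₃ + σ₁ r₁ r₂ r₃ →
          IsEll r₁ r₂ r₃ (u % σ₃ r₁ r₂ r₃)
isEll-% {r₁} {r₂} {r₃} u σ₃∣ = m%n<n u σ₃′ , ∣m+n∣m⇒∣n (subst (σ₃′ ∣_) split σ₃∣) (n∣m*n (u / σ₃′ * σ₂′))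
  where
  σ₃′ σ₂′ : ℕ
  σ₃′ = σ₃ r₁ r₂ r₃
  σ₂′ = σ₂ r₁ r₂ r₃
  split : u * σ₂′ + σ₁ r₁ r₂ r₃ ≡ u / σ₃′ * σ₂′ * σ₃′ + (u % σ₃′ * σ₂′ + σ₁ r₁ r₂ r₃)
  split = trans (cong (λ z → z * σ₂′ + σ₁ r₁ r₂ r₃) (m≡m%n+[m/n]*n u σ₃′)) (regroup (u % σ₃′) (u / σ₃′) σ₂′ σ₃′ (σ₁ r₁ r₂ r₃))
    where
    regroup : ∀ l t a s b → (l + t * s) * a + b ≡ t * a * s + (l * a + b)
    regroup = solve-∀

1≤τ : ∀ r₁ r₂ r₃ ℓ → 1 ≤ τ r₁ r₂ r₃ ℓ
1≤τ zero          r₂ r₃ ℓ = s≤s z≤n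
1≤τ (suc (suc _)) r₂ r₃ ℓ = s≤s z≤n
1≤τ (suc zero)    r₂ r₃ ℓ with ℓ <? σ₃ 1 r₂ r₃ ∸ σ₁ 1 r₂ r₃
... | yes _ = s≤s z≤n
... | no  _ = s≤s z≤n

τ≤t⇒2r₂r₃≤u+σ₁ : ∀ r₂ r₃ ℓ t → τ 1 r₂ r₃ ℓ ≤ t → 2 * (r₂ * r₃) ≤ σ₃ 1 r₂ r₃ * t + ℓ + r₂ + r₃ + 1
τ≤t⇒2r₂r₃≤u+σ₁ r₂ r₃ ℓ t τ≤t with ℓ <? σ₃ 1 r₂ r₃ ∸ σ₁ 1 r₂ r₃
... | yes _ = begin
  2 * (r₂ * r₃)            ≡⟨ cong (2 *_) r₂r₃≡S ⟩
  2 * S                    ≡⟨ *-comm 2 S ⟩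
  S * 2                    ≤⟨ *-monoʳ-≤ S τ≤t ⟩
  S * t                    ≤⟨ m≤m+n (S * t) (ℓ + r₂ + r₃ + 1) ⟩
  S * t + (ℓ + r₂ + r₃ + 1) ≡⟨ regroup (S * t) ℓ r₂ r₃ ⟩
  S * t + ℓ + r₂ + r₃ + 1  ∎
  where
  open ≤-Reasoning
  S : ℕ
  S = σ₃ 1 r₂ r₃
  r₂r₃≡S : r₂ * r₃ ≡ S
  r₂r₃≡S = cong (_* r₃) (sym (*-identityˡ r₂))
  regroup : ∀ a b c d → a + (b + c + d + 1) ≡ a + b + c + d + 1
  regroup = solve-∀
... | no ℓ≮ = begin
  2 * (r₂ * r₃)                   ≡⟨ cong (2 *_) r₂r₃≡S ⟩
  2 * S                           ≡⟨ regroup₁ S ⟩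
  S * 1 + S                       ≤⟨ +-mono-≤ (*-monoʳ-≤ S τ≤t) (m≤n+m∸n S (σ₁ 1 r₂ r₃)) ⟩
  S * t + (σ₁ 1 r₂ r₃ + (S ∸ σ₁ 1 r₂ r₃)) ≤⟨ +-monoʳ-≤ (S * t) (+-monoʳ-≤ (σ₁ 1 r₂ r₃) (≮⇒≥ ℓ≮)) ⟩
  S * t + (σ₁ 1 r₂ r₃ + ℓ)        ≡⟨ regroup₂ (S * t) ℓ r₂ r₃ ⟩
  S * t + ℓ + r₂ + r₃ + 1         ∎
  where
  open ≤-Reasoning
  S : ℕ
  S = σ₃ 1 r₂ r₃
  r₂r₃≡S : r₂ * r₃ ≡ S
  r₂r₃≡S = cong (_* r₃) (sym (*-identityˡ r₂))
  regroup₁ : ∀ S → 2 * S ≡ S * 1 + S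
  regroup₁ = solve-∀
  regroup₂ : ∀ a b c d → a + (1 + c + d + b) ≡ a + b + c + d + 1
  regroup₂ = solve-∀

carmichael⇒squareFree : ∀ {m} → Carmichael m → SquareFree m
carmichael⇒squareFree (m-composite , _) zero 0∣m =
  ⊥-elim (≢-nonZero⁻¹ _ {{composite⇒nonZero m-composite}} (0∣⇒≡0 0∣m))
carmichael⇒squareFree carm (suc zero)    _    = refl
carmichael⇒squareFree carm (suc (suc d)) dd∣m = ⊥-elim (carmichael-squarefree carm (s≤s (s≤s z≤n)) dd∣m)

prime∤* : ∀ {a b c} → Prime a → Prime b → Prime c → a ≢ b → a ≢ c → ¬ a ∣ b * c
prime∤* pa pb pc a≢b a≢c a∣bc with euclidsLemma _ _ pa a∣bc
... | inj₁ a∣b = a≢b (prime∣prime⇒≡ pa pb a∣b)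
... | inj₂ a∣c = a≢c (prime∣prime⇒≡ pa pc a∣c)

m+n<m*n : ∀ {m n} → 1 < m → m < n → m + n < m * n
m+n<m*n {m} {n} 1<m m<n = begin-strict
  m + n     <⟨ +-monoˡ-< n m<n ⟩
  n + n     ≡⟨ cong (n +_) (+-identityʳ n) ⟨
  2 * n     ≤⟨ *-monoˡ-≤ n 1<m ⟩
  m * n     ∎
  where open ≤-Reasoning

module CarmichaelTriple {m p₁ p₂ p₃ : ℕ} (carm : Carmichael m)
  (pp₁ : Prime p₁) (pp₂ : Prime p₂) (pp₃ : Prime p₃) (p₁<p₂ : p₁ < p₂) (p₂<p₃ : p₂ < p₃)
  (m≡p₁p₂p₃ : m ≡ p₁ * p₂ * p₃) where

  p₁<p₃ : p₁ < p₃
  p₁<p₃ = <-trans p₁<p₂ p₂<p₃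

  m≡p₁[p₂p₃] : m ≡ p₁ * (p₂ * p₃)
  m≡p₁[p₂p₃] = trans m≡p₁p₂p₃ (*-assoc p₁ p₂ p₃)
  m≡p₂[p₁p₃] : m ≡ p₂ * (p₁ * p₃)
  m≡p₂[p₁p₃] = trans m≡p₁p₂p₃ (xy∙z≈y∙xz p₁ p₂ p₃)
  m≡p₃[p₁p₂] : m ≡ p₃ * (p₁ * p₂)
  m≡p₃[p₁p₂] = trans m≡p₁p₂p₃ (xy∙z≈z∙xy p₁ p₂ p₃)

  p₁∣m : p₁ ∣ m
  p₁∣m = subst (p₁ ∣_) (sym m≡p₁[p₂p₃]) (m∣m*n _)
  p₂∣m : p₂ ∣ m
  p₂∣m = subst (p₂ ∣_) (sym m≡p₂[p₁p₃]) (m∣m*n _)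
  p₃∣m : p₃ ∣ m
  p₃∣m = subst (p₃ ∣_) (sym m≡p₃[p₁p₂]) (m∣m*n _)

  p₁-1∣m-1 : p₁ ∸ 1 ∣ m ∸ 1
  p₁-1∣m-1 = korselt carm pp₁ m≡p₁[p₂p₃] (prime∤* pp₁ pp₂ pp₃ (<⇒≢ p₁<p₂) (<⇒≢ p₁<p₃))
  p₂-1∣m-1 : p₂ ∸ 1 ∣ m ∸ 1
  p₂-1∣m-1 = korselt carm pp₂ m≡p₂[p₁p₃] (prime∤* pp₂ pp₁ pp₃ (>⇒≢ p₁<p₂) (<⇒≢ p₂<p₃))
  p₃-1∣m-1 : p₃ ∸ 1 ∣ m ∸ 1
  p₃-1∣m-1 = korselt carm pp₃ m≡p₃[p₁p₂] (prime∤* pp₃ pp₁ pp₂ (>⇒≢ p₁<p₃) (>⇒≢ p₂<p₃))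

  opaque
    u : ℕ
    u = gcd (gcd (p₁ ∸ 1) (p₂ ∸ 1)) (p₃ ∸ 1)

    u≡gcd : u ≡ gcd (gcd (p₁ ∸ 1) (p₂ ∸ 1)) (p₃ ∸ 1)
    u≡gcd = refl

    private
      u∣p₁-1 : u ∣ p₁ ∸ 1
      u∣p₁-1 = ∣-trans (gcd[m,n]∣m _ (p₃ ∸ 1)) (gcd[m,n]∣m (p₁ ∸ 1) (p₂ ∸ 1))
      u∣p₂-1 : u ∣ p₂ ∸ 1
      u∣p₂-1 = ∣-trans (gcd[m,n]∣m _ (p₃ ∸ 1)) (gcd[m,n]∣n (p₁ ∸ 1) (p₂ ∸ 1))
      u∣p₃-1 : u ∣ p₃ ∸ 1
      u∣p₃-1 = gcd[m,n]∣n (gcd (p₁ ∸ 1) (p₂ ∸ 1)) (p₃ ∸ 1)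

    ∣p-1⇒∣u : ∀ {d} → d ∣ p₁ ∸ 1 → d ∣ p₂ ∸ 1 → d ∣ p₃ ∸ 1 → d ∣ u
    ∣p-1⇒∣u d∣₁ d∣₂ d∣₃ = gcd-greatest (gcd-greatest d∣₁ d∣₂) d∣₃

    r₁ r₂ r₃ : ℕ
    r₁ = quotient u∣p₁-1
    r₂ = quotient u∣p₂-1
    r₃ = quotient u∣p₃-1

    p₁-1≡r₁u : p₁ ∸ 1 ≡ r₁ * u
    p₁-1≡r₁u = _∣_.equality u∣p₁-1
    p₂-1≡r₂u : p₂ ∸ 1 ≡ r₂ * u
    p₂-1≡r₂u = _∣_.equality u∣p₂-1
    p₃-1≡r₃u : p₃ ∸ 1 ≡ r₃ * u
    p₃-1≡r₃u = _∣_.equality u∣p₃-1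

  private
    prime≡[p-1]+1 : ∀ {p r} → Prime p → p ∸ 1 ≡ r * u → p ≡ r * u + 1
    prime≡[p-1]+1 pp p-1≡ = trans (sym (m∸n+n≡m (<-trans z<s (prime⇒>1 pp)))) (cong (_+ 1) p-1≡)

  p₁≡r₁u+1 : p₁ ≡ r₁ * u + 1
  p₁≡r₁u+1 = prime≡[p-1]+1 {r = r₁} pp₁ p₁-1≡r₁u
  p₂≡r₂u+1 : p₂ ≡ r₂ * u + 1
  p₂≡r₂u+1 = prime≡[p-1]+1 {r = r₂} pp₂ p₂-1≡r₂u
  p₃≡r₃u+1 : p₃ ≡ r₃ * u + 1
  p₃≡r₃u+1 = prime≡[p-1]+1 {r = r₃} pp₃ p₃-1≡r₃u

  0<r₁u : 0 < r₁ * u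
  0<r₁u = subst (0 <_) p₁-1≡r₁u (m<n⇒0<n∸m (prime⇒>1 pp₁))

  0<u : 0 < u
  0<u = n≢0⇒n>0 λ u≡0 → <⇒≢ 0<r₁u (sym (trans (cong (r₁ *_) u≡0) (*-zeroʳ r₁)))
  0<r₁ : 0 < r₁
  0<r₁ = n≢0⇒n>0 λ { r₁≡0 → <⇒≢ 0<r₁u (sym (cong (_* u) r₁≡0)) }

  instance
    u≢0 : NonZero u
    u≢0 = >-nonZero 0<u

  private
    r-mono : ∀ {p q r r′} → p ≡ r * u + 1 → q ≡ r′ * u + 1 → p < q → r < r′
    r-mono {r = r} {r′} p≡ q≡ p<q = *-cancelʳ-< u r r′ (+-cancelʳ-< 1 (r * u) (r′ * u) (subst₂ _<_ p≡ q≡ p<q))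

  r₁<r₂ : r₁ < r₂
  r₁<r₂ = r-mono p₁≡r₁u+1 p₂≡r₂u+1 p₁<p₂
  r₂<r₃ : r₂ < r₃
  r₂<r₃ = r-mono p₂≡r₂u+1 p₃≡r₃u+1 p₂<p₃

  0<r₂ : 0 < r₂
  0<r₂ = <-trans 0<r₁ r₁<r₂
  0<r₃ : 0 < r₃
  0<r₃ = <-trans 0<r₂ r₂<r₃
  1<r₂ : 1 < r₂
  1<r₂ = <-≤-trans (s≤s 0<r₁) r₁<r₂
  1<r₃ : 1 < r₃
  1<r₃ = <-trans 1<r₂ r₂<r₃

  private
    r∣Y : ∀ r a b {p q q′} → p ∸ 1 ≡ r * u → p ≡ r * u + 1 → q ≡ a * u + 1 → q′ ≡ b * u + 1 →
          m ≡ p * (q * q′) → p ∸ 1 ∣ m ∸ 1 → r ∣ a * b * u + a + b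
    r∣Y r a b p-1≡ p≡ q≡ q′≡ m≡ p-1∣m-1 = korselt-cofactor {r} {a} {b} 0<u
      (subst₂ (λ x y → x ∣ y ∸ 1) p-1≡ (trans m≡ (cong₂ _*_ p≡ (cong₂ _*_ q≡ q′≡))) p-1∣m-1)

  r₁∣Y₁ : r₁ ∣ r₂ * r₃ * u + r₂ + r₃
  r₁∣Y₁ = r∣Y r₁ r₂ r₃ p₁-1≡r₁u p₁≡r₁u+1 p₂≡r₂u+1 p₃≡r₃u+1 m≡p₁[p₂p₃] p₁-1∣m-1
  r₂∣Y₂ : r₂ ∣ r₁ * r₃ * u + r₁ + r₃
  r₂∣Y₂ = r∣Y r₂ r₁ r₃ p₂-1≡r₂u p₂≡r₂u+1 p₁≡r₁u+1 p₃≡r₃u+1 m≡p₂[p₁p₃] p₂-1∣m-1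
  r₃∣Y₃ : r₃ ∣ r₁ * r₂ * u + r₁ + r₂
  r₃∣Y₃ = r∣Y r₃ r₁ r₂ p₃-1≡r₃u p₃≡r₃u+1 p₁≡r₁u+1 p₂≡r₂u+1 m≡p₃[p₁p₂] p₃-1∣m-1

  common∣r⇒≡1 : ∀ {d} → d ∣ r₁ → d ∣ r₂ → d ∣ r₃ → d ≡ 1
  common∣r⇒≡1 {d} d∣r₁ d∣r₂ d∣r₃ = ∣1⇒≡1 (*-cancelʳ-∣ u (subst (d * u ∣_) (sym (*-identityˡ u)) du∣u))
    where
    du∣ : ∀ {n r} → n ≡ r * u → d ∣ r → d * u ∣ n
    du∣ p-1≡ d∣r = subst (d * u ∣_) (sym p-1≡) (*-monoˡ-∣ u d∣r)
    du∣u : d * u ∣ u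
    du∣u = ∣p-1⇒∣u (du∣ {r = r₁} p₁-1≡r₁u d∣r₁) (du∣ {r = r₂} p₂-1≡r₂u d∣r₂) (du∣ {r = r₃} p₃-1≡r₃u d∣r₃)

  r₁⊥r₂ : Coprime r₁ r₂
  r₁⊥r₂ (d∣r₁ , d∣r₂) = common∣r⇒≡1 d∣r₁ d∣r₂ (∣Y⇒∣ d∣r₁ r₁∣Y₁ d∣r₂)
  r₁⊥r₃ : Coprime r₁ r₃
  r₁⊥r₃ (d∣r₁ , d∣r₃) = common∣r⇒≡1 d∣r₁ (∣Y⇒∣ d∣r₁ (subst (r₁ ∣_) (Y-comm r₂ r₃ u) r₁∣Y₁) d∣r₃) d∣r₃
  r₂⊥r₃ : Coprime r₂ r₃
  r₂⊥r₃ (d∣r₂ , d∣r₃) = common∣r⇒≡1 (∣Y⇒∣ d∣r₂ (subst (r₂ ∣_) (Y-comm r₁ r₃ u) r₂∣Y₂) d∣r₃) d∣r₂ d∣r₃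

  r∈R : InR r₁ r₂ r₃
  r∈R = 0<r₁ , r₁<r₂ , r₂<r₃ , r₁⊥r₂ , r₁⊥r₃ , r₂⊥r₃

  instance
    σ₃≢0 : NonZero (σ₃ r₁ r₂ r₃)
    σ₃≢0 = >-nonZero (*-mono-≤ (*-mono-≤ 0<r₁ 0<r₂) 0<r₃)

  ℓ t : ℕ
  ℓ = u % σ₃ r₁ r₂ r₃
  t = u / σ₃ r₁ r₂ r₃

  u≡σ₃t+ℓ : u ≡ σ₃ r₁ r₂ r₃ * t + ℓ
  u≡σ₃t+ℓ = trans (m≡m%n+[m/n]*n u (σ₃ r₁ r₂ r₃))
    (trans (+-comm ℓ (t * σ₃ r₁ r₂ r₃)) (cong (_+ ℓ) (*-comm t (σ₃ r₁ r₂ r₃))))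

  ℓ-isEll : IsEll r₁ r₂ r₃ ℓ
  ℓ-isEll = isEll-% {r₁} {r₂} {r₃} u (σ₃∣uσ₂+σ₁ r₁⊥r₂ r₁⊥r₃ r₂⊥r₃ r₁∣Y₁ r₂∣Y₂ r₃∣Y₃)

  m≡U : m ≡ U r₁ r₂ r₃ ℓ t
  m≡U = trans m≡p₁p₂p₃ (trans (cong₂ _*_ (cong₂ _*_ p₁≡r₁u+1 p₂≡r₂u+1) p₃≡r₃u+1)
          (cong (λ z → (r₁ * z + 1) * (r₂ * z + 1) * (r₃ * z + 1)) u≡σ₃t+ℓ))

  0<t⇒σ₃≤u : 0 < t → σ₃ r₁ r₂ r₃ ≤ u
  0<t⇒σ₃≤u 0<t = begin
    σ₃ r₁ r₂ r₃              ≤⟨ m≤m*n (σ₃ r₁ r₂ r₃) t {{>-nonZero 0<t}} ⟩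
    σ₃ r₁ r₂ r₃ * t          ≤⟨ m≤m+n _ ℓ ⟩
    σ₃ r₁ r₂ r₃ * t + ℓ      ≡⟨ u≡σ₃t+ℓ ⟨
    u                        ∎
    where open ≤-Reasoning

  opaque
    K : ℕ
    K = quotient r₃∣Y₃

    r₃K≡Y₃ : r₃ * K ≡ r₁ * r₂ * u + r₁ + r₂
    r₃K≡Y₃ = trans (*-comm r₃ K) (sym (_∣_.equality r₃∣Y₃))

  2≤K : 2 ≤ K
  2≤K = quotient≥2 r₃K≡Y₃
    where
    quotient≥2 : ∀ {k} → r₃ * k ≡ r₁ * r₂ * u + r₁ + r₂ → 2 ≤ k
    quotient≥2 {zero} r₃0≡Y₃ =
      ⊥-elim (<⇒≢ (<-≤-trans 0<r₁ (≤-trans (m≤n+m r₁ _) (m≤m+n _ r₂))) (sym (trans (sym r₃0≡Y₃) (*-zeroʳ r₃))))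
    quotient≥2 {suc zero} r₃1≡Y₃ = ⊥-elim (<⇒≢ p₁<p₃ (prime∣prime⇒≡ pp₁ pp₃ (divides p₂ p₃≡p₂p₁)))
      where
      p₃≡p₂p₁ : p₃ ≡ p₂ * p₁
      p₃≡p₂p₁ = begin
        p₃                                  ≡⟨ p₃≡r₃u+1 ⟩
        r₃ * u + 1                          ≡⟨ cong (λ z → z * u + 1) (trans (sym (*-identityʳ r₃)) r₃1≡Y₃) ⟩
        (r₁ * r₂ * u + r₁ + r₂) * u + 1     ≡⟨ factor r₁ r₂ u ⟩
        (r₂ * u + 1) * (r₁ * u + 1)         ≡⟨ cong₂ _*_ p₂≡r₂u+1 p₁≡r₁u+1 ⟨
        p₂ * p₁                             ∎
        where
        open ≡-Reasoning
        factor : ∀ a b u → (a * b * u + a + b) * u + 1 ≡ (b * u + 1) * (a * u + 1)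
        factor = solve-∀
    quotient≥2 {suc (suc _)} _ = s≤s (s≤s z≤n)

  p₃<p₁p₂ : p₃ < p₁ * p₂
  p₃<p₁p₂ = begin-strict
    p₃                                ≡⟨ p₃≡r₃u+1 ⟩
    r₃ * u + 1                        <⟨ +-monoˡ-< 1 (m<m+n (r₃ * u) (*-mono-≤ 0<r₃ 0<u)) ⟩
    r₃ * u + r₃ * u + 1               ≡⟨ cong (_+ 1) (double r₃ u) ⟩
    r₃ * 2 * u + 1                    ≤⟨ +-monoˡ-≤ 1 (*-monoˡ-≤ u (*-monoʳ-≤ r₃ 2≤K)) ⟩
    r₃ * K * u + 1                    ≡⟨ cong (λ z → z * u + 1) r₃K≡Y₃ ⟩
    (r₁ * r₂ * u + r₁ + r₂) * u + 1   ≡⟨ factor r₁ r₂ u ⟩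
    (r₁ * u + 1) * (r₂ * u + 1)       ≡⟨ cong₂ _*_ p₁≡r₁u+1 p₂≡r₂u+1 ⟨
    p₁ * p₂                           ∎
    where
    open ≤-Reasoning
    double : ∀ r u → r * u + r * u ≡ r * 2 * u
    double = solve-∀
    factor : ∀ a b u → (a * b * u + a + b) * u + 1 ≡ (a * u + 1) * (b * u + 1)
    factor = solve-∀

  private
    s-self-cong : ∀ {p q q′ P Q Q′} → p ≡ P → q ≡ Q → q′ ≡ Q′ → s P (P * (Q * Q′)) ≡ P → s p (p * (q * q′)) ≡ p
    s-self-cong refl refl refl sP≡P = sP≡P

  s[p₃]≡p₃ : s p₃ m ≡ p₃
  s[p₃]≡p₃ = subst (λ n → s p₃ n ≡ p₃) (sym m≡p₃[p₁p₂]) (s-self-cong p₃≡r₃u+1 p₁≡r₁u+1 p₂≡r₂u+1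
               (s-self-twoDigits 0<u (<⇒≤ (<-trans r₁<r₂ r₂<r₃)) r₂<r₃ 2≤K r₃K≡Y₃))

  0<t⇒s[p₂]≡p₂ : 0 < t → s p₂ m ≡ p₂
  0<t⇒s[p₂]≡p₂ 0<t = subst (λ n → s p₂ n ≡ p₂) (sym m≡p₂[p₁p₃]) (s-self-cong p₂≡r₂u+1 p₁≡r₁u+1 p₃≡r₃u+1
    (s-self-threeDigits 1<r₂ 0<r₁ 0<r₃ (*-mono-≤ 0<r₁ 1<r₃) r₂∤r₁r₃ r₂∣Y₂
      (subst (_≤ u) (xy∙z≈y∙xz r₁ r₂ r₃) (0<t⇒σ₃≤u 0<t))))
    where
    r₂∤r₁r₃ : ¬ r₂ ∣ r₁ * r₃
    r₂∤r₁r₃ r₂∣r₁r₃ = >⇒≢ 1<r₂ (r₂⊥r₃ (∣-refl , coprime-divisor (coprime-sym r₁⊥r₂) r₂∣r₁r₃))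

  1<r₁⇒0<t⇒s[p₁]≡p₁ : 1 < r₁ → 0 < t → s p₁ m ≡ p₁
  1<r₁⇒0<t⇒s[p₁]≡p₁ 1<r₁ 0<t = subst (λ n → s p₁ n ≡ p₁) (sym m≡p₁[p₂p₃]) (s-self-cong p₁≡r₁u+1 p₂≡r₂u+1 p₃≡r₃u+1
    (s-self-threeDigits 1<r₁ 0<r₂ 0<r₃ (*-mono-≤ 0<r₂ 1<r₃) r₁∤r₂r₃ r₁∣Y₁
      (subst (_≤ u) (*-assoc r₁ r₂ r₃) (0<t⇒σ₃≤u 0<t))))
    where
    r₁∤r₂r₃ : ¬ r₁ ∣ r₂ * r₃
    r₁∤r₂r₃ r₁∣r₂r₃ = >⇒≢ 1<r₁ (r₁⊥r₃ (∣-refl , coprime-divisor r₁⊥r₂ r₁∣r₂r₃))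

  r₁≡1⇒τ≤t⇒s[p₁]≡p₁ : r₁ ≡ 1 → τ r₁ r₂ r₃ ℓ ≤ t → s p₁ m ≡ p₁
  r₁≡1⇒τ≤t⇒s[p₁]≡p₁ r₁≡1 τ≤t = subst (λ n → s p₁ n ≡ p₁) (sym m≡p₁[p₂p₃]) (s-self-cong p₁≡u+1 p₂≡r₂u+1 p₃≡r₃u+1
    (s-self-threeDigits-r≡1 0<r₂ 0<r₃ (m+n<m*n 1<r₂ r₂<r₃) 2r₂r₃≤))
    where
    p₁≡u+1 : p₁ ≡ u + 1
    p₁≡u+1 = trans p₁≡r₁u+1 (trans (cong (λ r → r * u + 1) r₁≡1) (cong (_+ 1) (*-identityˡ u)))
    2r₂r₃≤ : 2 * (r₂ * r₃) ≤ u + r₂ + r₃ + 1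
    2r₂r₃≤ = subst (λ z → 2 * (r₂ * r₃) ≤ z + r₂ + r₃ + 1) (sym (trans u≡σ₃t+ℓ (cong (λ r → σ₃ r r₂ r₃ * t + ℓ) r₁≡1)))
               (τ≤t⇒2r₂r₃≤u+σ₁ r₂ r₃ ℓ t (subst (λ r → τ r r₂ r₃ ℓ ≤ t) r₁≡1 τ≤t))

  prime∣m⇒∈ : ∀ {q} → Prime q → q ∣ m → q ≡ p₁ ⊎ q ≡ p₂ ⊎ q ≡ p₃
  prime∣m⇒∈ pq q∣m with euclidsLemma p₁ (p₂ * p₃) pq (subst (_ ∣_) m≡p₁[p₂p₃] q∣m)
  ... | inj₁ q∣p₁ = inj₁ (prime∣prime⇒≡ pq pp₁ q∣p₁)
  ... | inj₂ q∣p₂p₃ with euclidsLemma p₂ p₃ pq q∣p₂p₃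
  ...   | inj₁ q∣p₂ = inj₂ (inj₁ (prime∣prime⇒≡ pq pp₂ q∣p₂))
  ...   | inj₂ q∣p₃ = inj₂ (inj₂ (prime∣prime⇒≡ pq pp₃ q∣p₃))

  instance
    m≢0 : NonZero m
    m≢0 = composite⇒nonZero (proj₁ carm)

  1<m : 1 < m
  1<m = <-≤-trans (prime⇒>1 pp₁) (∣⇒≤ p₁∣m)

  m∈C₃′ : s p₁ m ≡ p₁ → s p₂ m ≡ p₂ → C3' m
  m∈C₃′ s[p₁]≡p₁ s[p₂]≡p₂ = 1<m , carmichael⇒squareFree carm , (p₁ , p₂ , p₃ , pp₁ , pp₂ , pp₃ , m≡p₁p₂p₃) , s[q]≡q
    where
    s[q]≡q : ∀ q → Prime q → q ∣ m → s q m ≡ q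
    s[q]≡q q pq q∣m with prime∣m⇒∈ pq q∣m
    ... | inj₁ refl        = s[p₁]≡p₁
    ... | inj₂ (inj₁ refl) = s[p₂]≡p₂
    ... | inj₂ (inj₂ refl) = s[p₃]≡p₃

  t<τ : ¬ C3' m → t < τ r₁ r₂ r₃ ℓ
  t<τ m∉C₃′ = ≰⇒> λ τ≤t → m∉C₃′ (m∈C₃′ (s[p₁]≡p₁ τ≤t) (0<t⇒s[p₂]≡p₂ (≤-trans (1≤τ r₁ r₂ r₃ ℓ) τ≤t)))
    where
    s[p₁]≡p₁ : τ r₁ r₂ r₃ ℓ ≤ t → s p₁ m ≡ p₁
    s[p₁]≡p₁ τ≤t with m≤n⇒m<n∨m≡n 0<r₁
    ... | inj₁ 1<r₁  = 1<r₁⇒0<t⇒s[p₁]≡p₁ 1<r₁ (≤-trans (1≤τ r₁ r₂ r₃ ℓ) τ≤t)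
    ... | inj₂ 1≡r₁  = r₁≡1⇒τ≤t⇒s[p₁]≡p₁ (sym 1≡r₁) τ≤t

  m≢q^j : ∀ {q q′} → Prime q → Prime q′ → q′ ≢ q → q′ ∣ m → ¬ (∃ λ j → m ≡ q ^ j)
  m≢q^j {q} pq pq′ q′≢q q′∣m (j , m≡q^j) = q′≢q (prime∣prime⇒≡ pq′ pq (prime∣^⇒∣ q j pq′ (subst (_ ∣_) m≡q^j q′∣m)))

  s≥ : ∀ {q q′} → Prime q → Prime q′ → q′ ≢ q → q′ ∣ m → q ∸ 1 ∣ m ∸ 1 → q ≤ s q m
  s≥ pq pq′ q′≢q q′∣m q-1∣m-1 = g≤s (prime⇒>1 pq) (>-nonZero⁻¹ m) q-1∣m-1 (m≢q^j pq pq′ q′≢q q′∣m)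

  m∈S′ : InS' m
  m∈S′ = ((p₁ , 1) ∷ (p₂ , 1) ∷ (p₃ , 1) ∷ []) , (λ ()) ,
    ( (≤-refl , prime⇒>1 pp₁ , p<m pp₁ pp₂ pp₃ m≡p₁[p₂p₃] , s≥ pp₁ pp₂ (>⇒≢ p₁<p₂) p₂∣m p₁-1∣m-1)
    ∷ (≤-refl , prime⇒>1 pp₂ , p<m pp₂ pp₁ pp₃ m≡p₂[p₁p₃] , s≥ pp₂ pp₁ (<⇒≢ p₁<p₂) p₁∣m p₂-1∣m-1)
    ∷ (≤-refl , prime⇒>1 pp₃ , p<m pp₃ pp₁ pp₂ m≡p₃[p₁p₂] , ≤-reflexive (sym s[p₃]≡p₃))
    ∷ []) ,
    (p₁<p₂ ∷ p₂<p₃ ∷ [-]) ,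
    trans (cong₂ _*_ (*-identityʳ p₁) (cong₂ _*_ (*-identityʳ p₂) (trans (*-identityʳ _) (*-identityʳ p₃))))
          (sym m≡p₁[p₂p₃])
    where
    p<m : ∀ {p q q′} → Prime p → Prime q → Prime q′ → m ≡ p * (q * q′) → p < m
    p<m pp pq pq′ m≡ = subst (_ <_) (sym m≡) (m<m*n _ _ {{prime⇒nonZero pp}} (*-mono-< (prime⇒>1 pq) (prime⇒>1 pq′)))

  m∈L : InL m
  m∈L = p₃ , prime⇒>1 pp₃ , p₃∣m , s[p₃]≡p₃

  s[greatest]≡ : ∀ p → GreatestPrimeDivisor m p → s p m ≡ p
  s[greatest]≡ p (pp , p∣m , greatest) with prime∣m⇒∈ pp p∣m
  ... | inj₁ refl        = ⊥-elim (<⇒≱ p₁<p₃ (greatest p₃ pp₃ p₃∣m))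
  ... | inj₂ (inj₁ refl) = ⊥-elim (<⇒≱ p₂<p₃ (greatest p₃ pp₃ p₃∣m))
  ... | inj₂ (inj₂ refl) = s[p₃]≡p₃

  private
    module _ {g : ℕ} (1<g : 1 < g) (sg≡g : s g m ≡ g) where
      cofactor≮ : ∀ {c} → g * c ≡ m → ¬ c < g
      cofactor≮ gc≡m c<g = <⇒≢ c<g (trans (sym (s[g*c]≡c 1<g c<g)) (trans (cong (s g) gc≡m) sg≡g))

    ≡prime⇒≡factor : ∀ {g p q} → Prime p → Prime q → g ≡ p → q ∣ g → g ≡ q
    ≡prime⇒≡factor pp pq refl q∣p = sym (prime∣prime⇒≡ pq pp q∣p)

  strictFactor≡prime : ∀ {g q} → g ∣ m → 1 < g → g < m → s g m ≡ g → Prime q → q ∣ g → g ≡ q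
  strictFactor≡prime {g} g∣m 1<g g<m sg≡g pq q∣g with ∣p*n⇒ pp₁ (subst (g ∣_) m≡p₁[p₂p₃] g∣m)
  ... | inj₁ g∣p₂p₃ with ∣p*n⇒ pp₂ g∣p₂p₃
  ...   | inj₁ g∣p₃ with prime⇒irreducible pp₃ g∣p₃
  ...     | inj₁ refl = ⊥-elim (<-irrefl refl 1<g)
  ...     | inj₂ refl = ≡prime⇒≡factor pp₃ pq refl q∣g
  strictFactor≡prime g∣m 1<g g<m sg≡g pq q∣g | inj₁ _ | inj₂ (h , refl , h∣p₃) with prime⇒irreducible pp₃ h∣p₃
  ...     | inj₁ refl = ≡prime⇒≡factor pp₂ pq (*-identityʳ p₂) q∣g
  ...     | inj₂ refl = ⊥-elim (cofactor≮ 1<g sg≡g (sym (trans m≡p₁[p₂p₃] (*-comm p₁ (p₂ * p₃))))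
                                  (<-≤-trans p₁<p₂ (m≤m*n p₂ p₃ {{prime⇒nonZero pp₃}})))
  strictFactor≡prime g∣m 1<g g<m sg≡g pq q∣g | inj₂ (h , refl , h∣p₂p₃) with ∣p*n⇒ pp₂ h∣p₂p₃
  ...   | inj₁ h∣p₃ with prime⇒irreducible pp₃ h∣p₃
  ...     | inj₁ refl = ≡prime⇒≡factor pp₁ pq (*-identityʳ p₁) q∣g
  ...     | inj₂ refl = ⊥-elim (cofactor≮ 1<g sg≡g (sym (trans m≡p₁p₂p₃ (xy∙z≈xz∙y p₁ p₂ p₃)))
                                  (<-≤-trans p₂<p₃ (m≤n*m p₃ p₁ {{prime⇒nonZero pp₁}})))
  strictFactor≡prime g∣m 1<g g<m sg≡g pq q∣g | inj₂ (h , refl , _) | inj₂ (h′ , refl , h′∣p₃) with prime⇒irreducible pp₃ h′∣p₃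
  ...     | inj₁ refl = ⊥-elim (cofactor≮ 1<g sg≡g (trans (cong (λ z → p₁ * z * p₃) (*-identityʳ p₂)) (sym m≡p₁p₂p₃))
                                  (subst (p₃ <_) (cong (p₁ *_) (sym (*-identityʳ p₂))) p₃<p₁p₂))
  ...     | inj₂ refl = ⊥-elim (<-irrefl (sym m≡p₁[p₂p₃]) g<m)

  m∉S : ¬ C3' m → ¬ InS m
  m∉S m∉C₃′ (gs , _ , factors , _ , ∏≡m) = m∉C₃′ (m∈C₃′ (s[q]≡q pp₁ p₁∣m) (s[q]≡q pp₂ p₂∣m))
    where
    s[q]≡q : ∀ {q} → Prime q → q ∣ m → s q m ≡ q
    s[q]≡q {q} pq q∣m with prime∣product⇒∃ _ pq factors (subst (q ∣_) (sym ∏≡m) q∣m)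
    ... | (g , zero)  , (() , _) , _
    ... | (g , suc e) , (_ , 1<g , g<m , sg≡g) , q∣gᵉ , gᵉ∣∏ = subst (λ x → s x m ≡ x) g≡q sg≡g
      where
      g∣m : g ∣ m
      g∣m = subst (g ∣_) ∏≡m (∣-trans (m∣m*n (g ^ e)) gᵉ∣∏)
      g≡q : g ≡ q
      g≡q = strictFactor≡prime g∣m 1<g g<m sg≡g pq (prime∣^⇒∣ g (suc e) pq q∣gᵉ)

sort3 : ∀ {P : ℕ → Set} {a b c} → P a → P b → P c → a ≢ b → a ≢ c → b ≢ c →
        ∃ λ x → ∃ λ y → ∃ λ z → P x × P y × P z × x < y × y < z × a * b * c ≡ x * y * z
sort3 {a = a} {b} {c} pa pb pc a≢b a≢c b≢c with <-cmp a b | <-cmp a c | <-cmp b c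
... | tri≈ _ a≡b _ | _            | _            = ⊥-elim (a≢b a≡b)
... | _            | tri≈ _ a≡c _ | _            = ⊥-elim (a≢c a≡c)
... | _            | _            | tri≈ _ b≡c _ = ⊥-elim (b≢c b≡c)
... | tri< a<b _ _ | tri< a<c _ _ | tri< b<c _ _ = a , b , c , pa , pb , pc , a<b , b<c , refl
... | tri< a<b _ _ | tri< a<c _ _ | tri> _ _ c<b = a , c , b , pa , pc , pb , a<c , c<b , xy∙z≈xz∙y a b c
... | tri< a<b _ _ | tri> _ _ c<a | tri< b<c _ _ = ⊥-elim (<-asym (<-trans a<b b<c) c<a)
... | tri< a<b _ _ | tri> _ _ c<a | tri> _ _ c<b = c , a , b , pc , pa , pb , c<a , a<b , xy∙z≈zx∙y a b c
... | tri> _ _ b<a | tri< a<c _ _ | tri< b<c _ _ = b , a , c , pb , pa , pc , b<a , a<c , xy∙z≈yx∙z a b c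
... | tri> _ _ b<a | tri< a<c _ _ | tri> _ _ c<b = ⊥-elim (<-asym (<-trans c<b b<a) a<c)
... | tri> _ _ b<a | tri> _ _ c<a | tri< b<c _ _ = b , c , a , pb , pc , pa , b<c , c<a , xy∙z≈yz∙x a b c
... | tri> _ _ b<a | tri> _ _ c<a | tri> _ _ c<b = c , b , a , pc , pb , pa , c<b , b<a , xy∙z≈zy∙x a b c

theorem5p2 : ∀ m → Carmichael m → ThreePrimeFactors m → ¬ C3' m →
    (InS' m × InL m × ¬ InS m) ×
    (∀ p → GreatestPrimeDivisor m p → s p m ≡ p) ×
    (∃ λ p₁ → ∃ λ p₂ → ∃ λ p₃ →
      Prime p₁ × Prime p₂ × Prime p₃ × p₁ < p₂ × p₂ < p₃ × m ≡ p₁ * p₂ * p₃ ×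
      (∃ λ r₁ → ∃ λ r₂ → ∃ λ r₃ →
        p₁ ∸ 1 ≡ r₁ * gcd (gcd (p₁ ∸ 1) (p₂ ∸ 1)) (p₃ ∸ 1) ×
        p₂ ∸ 1 ≡ r₂ * gcd (gcd (p₁ ∸ 1) (p₂ ∸ 1)) (p₃ ∸ 1) ×
        p₃ ∸ 1 ≡ r₃ * gcd (gcd (p₁ ∸ 1) (p₂ ∸ 1)) (p₃ ∸ 1) ×
        InR r₁ r₂ r₃ ×
        (∃ λ ℓ → IsEll r₁ r₂ r₃ ℓ ×
          (∃ λ t → m ≡ U r₁ r₂ r₃ ℓ t × t < τ r₁ r₂ r₃ ℓ ×
            (τ r₁ r₂ r₃ ℓ ≡ 2 → t ≡ 1 → s p₂ m ≡ p₂)))))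
theorem5p2 m carm (p , q , r , pp , pq , pr , m≡pqr) m∉C₃′
  with sort3 {Prime} pp pq pr p≢q p≢r q≢r
  where
  p≢q : p ≢ q
  p≢q refl = carmichael-squarefree carm (prime⇒>1 pp) (divides r (trans m≡pqr (*-comm (p * p) r)))
  p≢r : p ≢ r
  p≢r refl = carmichael-squarefree carm (prime⇒>1 pp) (divides q (trans m≡pqr (xy∙z≈y∙xz p q p)))
  q≢r : q ≢ r
  q≢r refl = carmichael-squarefree carm (prime⇒>1 pq) (divides p (trans m≡pqr (*-assoc p q q)))
... | p₁ , p₂ , p₃ , pp₁ , pp₂ , pp₃ , p₁<p₂ , p₂<p₃ , pqr≡p₁p₂p₃ =
  (m∈S′ , m∈L , m∉S m∉C₃′) , s[greatest]≡ ,
  p₁ , p₂ , p₃ , pp₁ , pp₂ , pp₃ , p₁<p₂ , p₂<p₃ , m≡p₁p₂p₃ ,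
  r₁ , r₂ , r₃ , with-gcd r₁ p₁-1≡r₁u , with-gcd r₂ p₂-1≡r₂u , with-gcd r₃ p₃-1≡r₃u , r∈R ,
  ℓ , ℓ-isEll , t , m≡U , t<τ m∉C₃′ , λ _ t≡1 → 0<t⇒s[p₂]≡p₂ (≤-reflexive (sym t≡1))
  where
  m≡p₁p₂p₃ : m ≡ p₁ * p₂ * p₃
  m≡p₁p₂p₃ = trans m≡pqr pqr≡p₁p₂p₃
  open CarmichaelTriple carm pp₁ pp₂ pp₃ p₁<p₂ p₂<p₃ m≡p₁p₂p₃
  with-gcd : ∀ r {n} → n ≡ r * u → n ≡ r * gcd (gcd (p₁ ∸ 1) (p₂ ∸ 1)) (p₃ ∸ 1)
  with-gcd r n≡ru = trans n≡ru (cong (r *_) u≡gcd)
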